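{- Let $(\Gamma,\psi)$ be a model of $T_{\log}$ and let $(\Gamma_0,\psi)\preccurlyeq(\Gamma,\psi)$ be an elementary substructure (in the language $\mathcal{L}_{\log}$). Given $c_1,\ldots,c_m\in\Gamma\setminus\Gamma_0$, we have \[\#\Big(p\big(\Gamma_0+\textstyle\sum_{i=1}^m\mathbb{Q}c_i\big)\setminus p(\Gamma_0)\Big)\le m+1.\] In particular, there are $n\le m+1$ and distinct $d_1,\ldots,d_n\in p\big(\Gamma_0+\sum_{i=1}^m\mathbb{Q}c_i\big)\setminus p(\Gamma_0)$ such that \[p\big(\Gamma_0+\textstyle\sum_{i=1}^m\mathbb{Q}c_i\big)\subseteq\Big(\big(\bigoplus_{\alpha\in p(\Gamma_0),\,\alpha\ne\infty}\mathbb{Q}\alpha\big)\oplus\big(\bigoplus_{j=1}^n\mathbb{Q}d_j\big)\Big)\cup\{\infty\}.\]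
   Context: $\mathcal{L}_{\log}=\{0,+,-,<,\psi,\infty,s,p,\delta_1,\delta_2,\ldots\}$. An asymptotic couple is $(\Gamma,\psi)$ with $\Gamma$ an ordered abelian group, $\psi:\Gamma\setminus\{0\}\to\Gamma$ with, for nonzero $\alpha,\beta$: $\alpha+\beta\ne0\Rightarrow\psi(\alpha+\beta)\ge\min(\psi(\alpha),\psi(\beta))$; $\psi(k\alpha)=\psi(\alpha)$ for nonzero integers $k$; $\alpha>0\Rightarrow\alpha+\psi(\alpha)>\psi(\beta)$; $H$-type: $0<\alpha\le\beta\Rightarrow\psi(\alpha)\ge\psi(\beta)$. $\psi(0)=\infty$, $\Psi=\psi(\Gamma\setminus\{0\})$, $\alpha'=\alpha+\psi(\alpha)$; asymptotic integration: each $\gamma$ equals $\alpha'$ for a unique $\alpha\neq0$, written $\int\gamma$; $s(\gamma)=\psi(\int\gamma)$. Models of $T_{\log}$: divisible $H$-asymptotic couples with asymptotic integration such that $\Psi$ has least element $s(0)>0$, each $\alpha\in\Psi$ has immediate successor $s(\alpha)$ in $\Psi$, and $s:\Psi\to\Psi^{>s(0)}$ is a bijection; $p$ is its inverse on $\Psi^{>s(0)}$ and $p(\alpha)=\infty$ for all other $\alpha\in\Gamma\cup\{\infty\}$; underlying set $\Gamma\cup\{\infty\}$, $\Gamma<\infty$, $\delta_n$ division by $n$, $\infty$ default value of all functions. (The set $\Psi$ is $\mathbb{Q}$-linearly independent in such models.) -}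

module Defs where

open import Data.Nat using (ℕ; zero; suc; _≤_)
open import Data.Fin using (Fin; zero; suc)
open import Data.Integer using (ℤ; +_; -[1+_])
open import Data.Rational using (ℚ)
open import Data.Product using (Σ; ∃; _×_; _,_; proj₁)
open import Data.Sum using (_⊎_)
open import Data.Unit using (⊤)
open import Data.Empty using (⊥)
open import Relation.Nullary using (¬_)
open import Relation.Binary.PropositionalEquality using (_≡_; _≢_)
open import Function using (_⇔_)
open import Function.Definitions using (Injective)

-- L_log-structures.  The carrier is Γ ∪ {∞}; δ k is division by (k+1),
-- i.e. δ k is the symbol δ_{k+1}.

record LlogStr : Set₁ where
  field
    Car  : Set
    𝟘    : Car
    ∞    : Car
    _⊕_  : Car → Car → Car
    ⊝_   : Car → Car
    _≺_  : Car → Car → Set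
    ψ    : Car → Car
    s    : Car → Car
    p    : Car → Car
    δ    : ℕ → Car → Car

module _ (M : LlogStr) where
  open LlogStr M

  InΓ : Car → Set
  InΓ x = x ≢ ∞

  _≼_ : Car → Car → Set
  x ≼ y = x ≺ y ⊎ x ≡ y

  natMul : ℕ → Car → Car
  natMul zero    x = 𝟘
  natMul (suc n) x = x ⊕ natMul n x

  zMul : ℤ → Car → Car
  zMul (+ n)      x = natMul n x
  zMul -[1+ n ]   x = ⊝ natMul (suc n) x

  qMul : ℚ → Car → Car
  qMul q x = δ (ℚ.denominator-1 q) (zMul (ℚ.numerator q) x)

  sumFin : ∀ {m} → (Fin m → Car) → Car
  sumFin {zero}  f = 𝟘
  sumFin {suc m} f = f zero ⊕ sumFin (λ i → f (suc i))

  InΨ : Car → Set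
  InΨ x = Σ Car λ α → InΓ α × α ≢ 𝟘 × ψ α ≡ x

  record IsTlog : Set where
    field
      𝟘-Γ     : InΓ 𝟘
      ⊕-Γ     : ∀ x y → InΓ x → InΓ y → InΓ (x ⊕ y)
      ⊝-Γ     : ∀ x → InΓ x → InΓ (⊝ x)
      ⊕-assoc : ∀ x y z → InΓ x → InΓ y → InΓ z → (x ⊕ y) ⊕ z ≡ x ⊕ (y ⊕ z)
      ⊕-comm  : ∀ x y → InΓ x → InΓ y → x ⊕ y ≡ y ⊕ x
      ⊕-idʳ   : ∀ x → InΓ x → x ⊕ 𝟘 ≡ x
      ⊕-invʳ  : ∀ x → InΓ x → x ⊕ (⊝ x) ≡ 𝟘
      ⊕-∞ˡ    : ∀ x → ∞ ⊕ x ≡ ∞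
      ⊕-∞ʳ    : ∀ x → x ⊕ ∞ ≡ ∞
      ⊝-∞     : ⊝ ∞ ≡ ∞
      ≺-irrefl : ∀ x → ¬ (x ≺ x)
      ≺-trans  : ∀ x y z → x ≺ y → y ≺ z → x ≺ z
      ≺-tri    : ∀ x y → InΓ x → InΓ y → x ≺ y ⊎ x ≡ y ⊎ y ≺ x
      ≺-⊕      : ∀ x y z → InΓ x → InΓ y → InΓ z → x ≺ y → (x ⊕ z) ≺ (y ⊕ z)
      ≺-∞      : ∀ x → InΓ x → x ≺ ∞
      ∞-≺      : ∀ x → ¬ (∞ ≺ x)
      δ-Γ     : ∀ k x → InΓ x → InΓ (δ k x)
      δ-div   : ∀ k x → InΓ x → natMul (suc k) (δ k x) ≡ x
      δ-∞     : ∀ k → δ k ∞ ≡ ∞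
      ψ-𝟘     : ψ 𝟘 ≡ ∞
      ψ-∞     : ψ ∞ ≡ ∞
      ψ-Γ     : ∀ α → InΓ α → α ≢ 𝟘 → InΓ (ψ α)
      AC1     : ∀ α β → InΓ α → InΓ β → α ≢ 𝟘 → β ≢ 𝟘 → α ⊕ β ≢ 𝟘 →
                  ψ α ≼ ψ (α ⊕ β) ⊎ ψ β ≼ ψ (α ⊕ β)
      AC2     : ∀ (k : ℤ) α → InΓ α → α ≢ 𝟘 → k ≢ + 0 → ψ (zMul k α) ≡ ψ α
      AC3     : ∀ α β → InΓ α → InΓ β → β ≢ 𝟘 → 𝟘 ≺ α → ψ β ≺ (α ⊕ ψ α)
      H-type  : ∀ α β → InΓ α → InΓ β → 𝟘 ≺ α → α ≼ β → ψ β ≼ ψ α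
      -- asymptotic integration, and s γ = ψ (∫ γ)
      asInt   : ∀ γ → InΓ γ → Σ Car λ α → InΓ α × α ≢ 𝟘 × α ⊕ ψ α ≡ γ × s γ ≡ ψ α
      asInt-unique : ∀ α β → InΓ α → InΓ β → α ≢ 𝟘 → β ≢ 𝟘 →
                  α ⊕ ψ α ≡ β ⊕ ψ β → α ≡ β
      s-∞     : s ∞ ≡ ∞
      s0-Ψ    : InΨ (s 𝟘)
      s0-pos  : 𝟘 ≺ s 𝟘
      s0-least : ∀ x → InΨ x → s 𝟘 ≼ x
      s-Ψ     : ∀ α → InΨ α → InΨ (s α)
      s-succ  : ∀ α → InΨ α → α ≺ s α
      s-imm   : ∀ α β → InΨ α → InΨ β → α ≺ β → ¬ (β ≺ s α)
      s-surj  : ∀ β → InΨ β → s 𝟘 ≺ β → Σ Car λ α → InΨ α × s α ≡ β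
      p-Ψ     : ∀ β → InΨ β → s 𝟘 ≺ β → InΨ (p β) × s (p β) ≡ β
      p-else  : ∀ β → ¬ (InΨ β × s 𝟘 ≺ β) → p β ≡ ∞

data Term (n : ℕ) : Set where
  var   : Fin n → Term n
  t𝟘 t∞ : Term n
  tadd  : Term n → Term n → Term n
  tneg tψ ts tp : Term n → Term n
  tδ    : ℕ → Term n → Term n

data Formula : ℕ → Set where
  _≐_  : ∀ {n} → Term n → Term n → Formula n
  flt  : ∀ {n} → Term n → Term n → Formula n
  f⊥   : ∀ {n} → Formula n
  _f⇒_ _f∧_ _f∨_ : ∀ {n} → Formula n → Formula n → Formula n
  f∀ f∃ : ∀ {n} → Formula (suc n) → Formula n

module _ (M : LlogStr) where
  open LlogStr M

  ext : ∀ {n} → Car → (Fin n → Car) → Fin (suc n) → Car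
  ext x e zero    = x
  ext x e (suc i) = e i

  eval : ∀ {n} → (Fin n → Car) → Term n → Car
  eval e (var i)    = e i
  eval e t𝟘         = 𝟘
  eval e t∞         = ∞
  eval e (tadd t u) = eval e t ⊕ eval e u
  eval e (tneg t)   = ⊝ eval e t
  eval e (tψ t)     = ψ (eval e t)
  eval e (ts t)     = s (eval e t)
  eval e (tp t)     = p (eval e t)
  eval e (tδ k t)   = δ k (eval e t)

  -- Satisfaction with quantifiers relativised to a domain D ⊆ Car
  -- (D = everything gives satisfaction in M; D = a substructure gives
  -- satisfaction in that substructure).
  SatIn : (D : Car → Set) → ∀ {n} → Formula n → (Fin n → Car) → Set
  SatIn D (t ≐ u)   e = eval e t ≡ eval e u
  SatIn D (flt t u) e = eval e t ≺ eval e u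
  SatIn D f⊥        e = ⊥
  SatIn D (φ f⇒ χ)  e = SatIn D φ e → SatIn D χ e
  SatIn D (φ f∧ χ)  e = SatIn D φ e × SatIn D χ e
  SatIn D (φ f∨ χ)  e = SatIn D φ e ⊎ SatIn D χ e
  SatIn D (f∀ φ)    e = ∀ x → D x → SatIn D φ (ext x e)
  SatIn D (f∃ φ)    e = Σ Car λ x → D x × SatIn D φ (ext x e)

  record IsSubstructure (G₀ : Car → Set) : Set where
    field
      𝟘∈ : G₀ 𝟘
      ∞∈ : G₀ ∞
      ⊕∈ : ∀ x y → G₀ x → G₀ y → G₀ (x ⊕ y)
      ⊝∈ : ∀ x → G₀ x → G₀ (⊝ x)
      ψ∈ : ∀ x → G₀ x → G₀ (ψ x)
      s∈ : ∀ x → G₀ x → G₀ (s x)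
      p∈ : ∀ x → G₀ x → G₀ (p x)
      δ∈ : ∀ k x → G₀ x → G₀ (δ k x)

  IsElementarySubstructure : (G₀ : Car → Set) → Set
  IsElementarySubstructure G₀ =
    IsSubstructure G₀ ×
    (∀ {n} (φ : Formula n) (e : Fin n → Car) → (∀ i → G₀ (e i)) →
       SatIn G₀ φ e ⇔ SatIn (λ _ → ⊤) φ e)

  module _ (G₀ : Car → Set) {m : ℕ} (c : Fin m → Car) where

    -- Γ₀ + Σ_i ℚ c_i  (Γ₀ here is the group part G₀ ∖ {∞})
    InExt : Car → Set
    InExt x = Σ Car λ g → G₀ g × InΓ M g × Σ (Fin m → ℚ) λ q →
                x ≡ g ⊕ sumFin M (λ i → qMul M (q i) (c i))

    InPExt : Car → Set
    InPExt y = Σ Car λ x → InExt x × p x ≡ y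

    InPΓ₀ : Car → Set
    InPΓ₀ y = Σ Car λ x → G₀ x × InΓ M x × p x ≡ y

    InNew : Car → Set
    InNew y = InPExt y × ¬ InPΓ₀ y

    NewCard≤ : ℕ → Set
    NewCard≤ N = ∀ k (d : Fin k → Car) → Injective _≡_ _≡_ d →
                   (∀ j → InNew (d j)) → k ≤ N

    -- y ∈ (⊕_{α ∈ p(Γ₀), α ≠ ∞} ℚα) ⊕ (⊕_j ℚ d_j)   (as a set: the ℚ-span)
    InSpan : ∀ {n} → (Fin n → Car) → Car → Set
    InSpan {n} d y = Σ ℕ λ k → Σ (Fin k → Car) λ a →
                       (∀ i → InPΓ₀ (a i) × InΓ M (a i)) ×
                       Σ (Fin k → ℚ) λ q → Σ (Fin n → ℚ) λ r →
                       y ≡ sumFin M (λ i → qMul M (q i) (a i))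
                           ⊕ sumFin M (λ j → qMul M (r j) (d j))

-- A new element of p(Γ₀ + Σ ℚ c_i) is p(x) with x = g + Σ q_i c_i ∈ Ψ ∖ Γ₀.
-- The coordinate vectors q ∈ ℚ^m of m+1 such elements x_j are linearly
-- dependent, so some nontrivial combination Σ r_j x_j = h lies in Γ₀.  The
-- statement "there are distinct y_j in the domain of p with Σ r_j y_j = h" has
-- its parameters in Γ₀, so by elementarity it has witnesses y_j ∈ Γ₀, and
-- Σ r_j x_j - Σ r_j y_j = 0 is a nontrivial ℚ-relation between distinct
-- elements of Ψ.  This is impossible: for α < β in Ψ we have ψ(β - α) = s(α),
-- so after subtracting the largest element the terms have distinct ψ-values.
-- Hence there are at most m new elements, and a maximal family of them spans
-- p(Γ₀ + Σ ℚ c_i) together with p(Γ₀).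

module Submission where

open import Defs
open import Level using (0ℓ)
open import Axiom.ExcludedMiddle using (ExcludedMiddle)
open import Algebra.Bundles using (AbelianGroup; CommutativeRing)
import Algebra.Properties.AbelianGroup as AbelianGroupProperties
import Algebra.Properties.CommutativeSemigroup as CommutativeSemigroupProperties
open import Data.Nat as ℕ using (ℕ; zero; suc; _≤_; _<_)
import Data.Nat.Properties as ℕP
open import Data.Fin using (Fin; zero; suc; punchIn; splitAt; _↑ˡ_; _↑ʳ_; inject≤)
import Data.Fin.Properties as FinP
open import Data.Integer as ℤ using (ℤ; +_; -[1+_]; _⊖_)
import Data.Integer.Properties as ℤP
import Data.Integer.Solver as ℤ-Solver
open import Data.Rational as ℚ using (ℚ; ↥_; ↧_; ↧ₙ_; 0ℚ; 1ℚ)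
import Data.Rational.Properties as ℚP
import Data.Rational.Unnormalised as ℚᵘ
open import Data.Product using (Σ; ∃; _×_; _,_; proj₁; proj₂)
open import Data.Sum using (_⊎_; inj₁; inj₂)
open import Data.Sum.Properties using ([,]-map)
open import Data.Empty using (⊥; ⊥-elim)
open import Data.Unit using (⊤; tt)
open import Data.Vec.Functional using (_++_; _∷_; insertAt)
open import Data.Vec.Functional.Properties using (insertAt-lookup; insertAt-punchIn; lookup-++ˡ)
open import Data.Vec.Functional.Relation.Unary.All.Properties using (++⁺)
open import Relation.Nullary using (¬_; Dec; yes; no)
open import Relation.Nullary.Decidable using (decidable-stable)
open import Relation.Binary.PropositionalEquality
open import Function using (_⇔_; mk⇔; Equivalence; id)
open import Function.Definitions using (Injective)
open import Algebra.Properties.Semiring.Sum (CommutativeRing.semiring ℚP.+-*-commutativeRing)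
  using (sum-remove; ∑-distrib-+; *-distribʳ-sum; sum-cong-≗; sum-replicate-zero)
  renaming (sum to ∑ℚ)

-- Linear algebra over ℚ

module RationalMatrices where
  open import Data.Rational using (_+_; _*_; -_; _-_; 1/_; NonZero; ≢-nonZero)
  open import Data.Rational.Solver using (module +-*-Solver)

  LinearlyDependent : ∀ {n m} → (Fin n → Fin m → ℚ) → Set
  LinearlyDependent {n} Q =
    Σ (Fin n → ℚ) λ r → (∃ λ j → r j ≢ 0ℚ) × (∀ i → ∑ℚ (λ j → r j * Q j i) ≡ 0ℚ)

  dependent-if-column-zero : ∀ {n m} (Q : Fin (suc n) → Fin (suc m) → ℚ) →
    (∀ j → Q j zero ≡ 0ℚ) → LinearlyDependent (λ j i → Q (suc j) (suc i)) →
    LinearlyDependent Q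
  dependent-if-column-zero {n} Q column-zero (r , (j , rj≢0) , r-kills) =
    r′ , (suc j , rj≢0) , r′-kills
    where
      r′ : Fin (suc n) → ℚ
      r′ zero    = 0ℚ
      r′ (suc j) = r j
      r′-kills : ∀ i → ∑ℚ (λ j → r′ j * Q j i) ≡ 0ℚ
      r′-kills zero = begin
        0ℚ * Q zero zero + ∑ℚ (λ j → r j * Q (suc j) zero)
          ≡⟨ cong₂ _+_ (ℚP.*-zeroˡ (Q zero zero)) (sum-cong-≗ λ j → trans (cong (r j *_) (column-zero (suc j))) (ℚP.*-zeroʳ (r j))) ⟩
        0ℚ + ∑ℚ {n} (λ _ → 0ℚ)
          ≡⟨ sum-replicate-zero (suc n) ⟩
        0ℚ ∎
        where open ≡-Reasoning
      r′-kills (suc i) = trans (cong₂ _+_ (ℚP.*-zeroˡ (Q zero (suc i))) (r-kills i)) (ℚP.+-identityʳ 0ℚ)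

  -- A dependency r of the rows reduced by the pivot row j₀ lifts to Q, with
  -- coefficient - Σ_j r_j (weight j) on row j₀.
  module Pivot {n m} (Q : Fin (suc n) → Fin (suc m) → ℚ) (j₀ : Fin (suc n))
               (pivot≢0 : Q j₀ zero ≢ 0ℚ) where

    instance
      _ : NonZero (Q j₀ zero)
      _ = ≢-nonZero pivot≢0

    weight : Fin n → ℚ
    weight j = Q (punchIn j₀ j) zero * 1/ (Q j₀ zero)

    reduced : Fin n → Fin (suc m) → ℚ
    reduced j i = Q (punchIn j₀ j) i - weight j * Q j₀ i

    reduced-column-zero : ∀ j → reduced j zero ≡ 0ℚ
    reduced-column-zero j = begin
      a - (a * 1/ p) * p   ≡⟨ cong (λ u → a - u) (ℚP.*-assoc a (1/ p) p) ⟩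
      a - a * (1/ p * p)   ≡⟨ cong (λ u → a - a * u) (ℚP.*-inverseˡ p) ⟩
      a - a * 1ℚ           ≡⟨ cong (λ u → a - u) (ℚP.*-identityʳ a) ⟩
      a - a                ≡⟨ ℚP.+-inverseʳ a ⟩
      0ℚ ∎
      where
        open ≡-Reasoning
        a = Q (punchIn j₀ j) zero
        p = Q j₀ zero

    dependent : LinearlyDependent (λ j i → reduced j (suc i)) → LinearlyDependent Q
    dependent (r , (j , rj≢0) , r-kills) = r′ , (punchIn j₀ j , r′j≢0) , r′-kills
      where
        S = ∑ℚ (λ j → r j * weight j)
        r′ = insertAt r j₀ (- S)
        r′j≢0 : r′ (punchIn j₀ j) ≢ 0ℚ
        r′j≢0 = subst (_≢ 0ℚ) (sym (insertAt-punchIn r j₀ (- S) j)) rj≢0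

        shift : ∀ a b w k → a * b ≡ a * (b - w * k) + (a * w) * k
        shift = solve 4 (λ a b w k → a :* b := a :* (b :- w :* k) :+ (a :* w) :* k) refl
          where open +-*-Solver

        cancel : ∀ s e k → (- s) * k + (e + s * k) ≡ e
        cancel = solve 3 (λ s e k → (:- s) :* k :+ (e :+ s :* k) := e) refl
          where open +-*-Solver

        column : ∀ i → ∑ℚ (λ j → r′ j * Q j i) ≡ ∑ℚ (λ j → r j * reduced j i)
        column i = begin
          ∑ℚ (λ j → r′ j * Q j i)
            ≡⟨ sum-remove {i = j₀} (λ j → r′ j * Q j i) ⟩
          r′ j₀ * K + ∑ℚ (λ j → r′ (punchIn j₀ j) * Q (punchIn j₀ j) i)
            ≡⟨ cong₂ _+_ (cong (_* K) (insertAt-lookup r j₀ (- S)))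
                         (sum-cong-≗ λ j → cong (_* Q (punchIn j₀ j) i) (insertAt-punchIn r j₀ (- S) j)) ⟩
          (- S) * K + ∑ℚ (λ j → r j * Q (punchIn j₀ j) i)
            ≡⟨ cong (λ u → (- S) * K + u) (sum-cong-≗ λ j → shift (r j) _ (weight j) K) ⟩
          (- S) * K + ∑ℚ (λ j → r j * reduced j i + (r j * weight j) * K)
            ≡⟨ cong (λ u → (- S) * K + u) (∑-distrib-+ (λ j → r j * reduced j i) (λ j → (r j * weight j) * K)) ⟩
          (- S) * K + (∑ℚ (λ j → r j * reduced j i) + ∑ℚ (λ j → (r j * weight j) * K))
            ≡⟨ cong (λ u → (- S) * K + (∑ℚ (λ j → r j * reduced j i) + u)) (sym (*-distribʳ-sum K (λ j → r j * weight j))) ⟩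
          (- S) * K + (∑ℚ (λ j → r j * reduced j i) + S * K)
            ≡⟨ cancel S _ K ⟩
          ∑ℚ (λ j → r j * reduced j i) ∎
          where
            open ≡-Reasoning
            K = Q j₀ i

        r′-kills : ∀ i → ∑ℚ (λ j → r′ j * Q j i) ≡ 0ℚ
        r′-kills zero = trans (column zero) (trans
          (sum-cong-≗ λ j → trans (cong (r j *_) (reduced-column-zero j)) (ℚP.*-zeroʳ (r j)))
          (sum-replicate-zero n))
        r′-kills (suc i) = trans (column (suc i)) (r-kills i)

  rows-dependent : ∀ m (Q : Fin (suc m) → Fin m → ℚ) → LinearlyDependent Q
  rows-dependent zero    Q = (λ _ → 1ℚ) , (zero , λ ()) , λ ()
  rows-dependent (suc m) Q with FinP.all? (λ j → Q j zero ℚP.≟ 0ℚ)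
  ... | yes column-zero =
    dependent-if-column-zero Q column-zero (rows-dependent m (λ j i → Q (suc j) (suc i)))
  ... | no ¬column-zero with FinP.¬∀⟶∃¬ _ _ (λ j → Q j zero ℚP.≟ 0ℚ) ¬column-zero
  ...   | j₀ , pivot≢0 =
    Pivot.dependent Q j₀ pivot≢0 (rows-dependent m (λ j i → Pivot.reduced Q j₀ pivot≢0 j (suc i)))

open RationalMatrices using (LinearlyDependent; rows-dependent)

-- Finite families

++-injective : ∀ {A : Set} {m n} (xs : Fin m → A) (ys : Fin n → A) →
  Injective _≡_ _≡_ xs → Injective _≡_ _≡_ ys → (∀ i j → xs i ≢ ys j) →
  Injective _≡_ _≡_ (xs ++ ys)
++-injective {m = m} {n} xs ys xs-inj ys-inj disjoint {l} {l′} eq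
  with splitAt m l in e | splitAt m l′ in e′
... | inj₁ i | inj₁ i′ =
  trans (sym (FinP.splitAt⁻¹-↑ˡ e)) (trans (cong (_↑ˡ n) (xs-inj eq)) (FinP.splitAt⁻¹-↑ˡ e′))
... | inj₁ i | inj₂ j′ = ⊥-elim (disjoint i j′ eq)
... | inj₂ j | inj₁ i′ = ⊥-elim (disjoint i′ j (sym eq))
... | inj₂ j | inj₂ j′ =
  trans (sym (FinP.splitAt⁻¹-↑ʳ e)) (trans (cong (m ↑ʳ_) (ys-inj eq)) (FinP.splitAt⁻¹-↑ʳ e′))

∷-injective : ∀ {A : Set} {k} (y : A) (d : Fin k → A) → Injective _≡_ _≡_ d →
  ¬ (∃ λ j → d j ≡ y) → Injective _≡_ _≡_ (y ∷ d)
∷-injective y d d-inj y∉d {zero}  {zero}   eq = refl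
∷-injective y d d-inj y∉d {zero}  {suc j′} eq = ⊥-elim (y∉d (j′ , sym eq))
∷-injective y d d-inj y∉d {suc j} {zero}   eq = ⊥-elim (y∉d (j , eq))
∷-injective y d d-inj y∉d {suc j} {suc j′} eq = cong suc (d-inj eq)

module _ (em : ExcludedMiddle 0ℓ) {A : Set} (P : A → Set) where

  CardinalityBound : ℕ → Set
  CardinalityBound N = ∀ k (d : Fin k → A) → Injective _≡_ _≡_ d → (∀ j → P (d j)) → k ≤ N

  Enumeration : ℕ → Set
  Enumeration N = Σ ℕ λ n → n ≤ N × Σ (Fin n → A) λ d →
    Injective _≡_ _≡_ d × (∀ j → P (d j)) × (∀ y → P y → ∃ λ j → d j ≡ y)

  -- Add missing elements of P one at a time; the invariant N < fuel + k
  -- ensures the fuel cannot run out before the cardinality bound is violated.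
  enumerate-from : ∀ {N} → CardinalityBound N → ∀ fuel k (d : Fin k → A) →
    Injective _≡_ _≡_ d → (∀ j → P (d j)) → N < fuel ℕ.+ k → Enumeration N
  enumerate-from {N} card≤ fuel k d d-inj Pd N<
    with em {Σ A λ y → P y × ¬ (∃ λ j → d j ≡ y)}
  ... | no nothing-missing = k , card≤ k d d-inj Pd , d , d-inj , Pd , λ y Py →
    decidable-stable em (λ y∉d → nothing-missing (y , Py , y∉d))
  enumerate-from card≤ zero k d d-inj Pd N< | yes _ = ⊥-elim (ℕP.<⇒≱ N< (card≤ k d d-inj Pd))
  enumerate-from {N} card≤ (suc fuel) k d d-inj Pd N< | yes (y , Py , y∉d) =
    enumerate-from card≤ fuel (suc k) (y ∷ d) (∷-injective y d d-inj y∉d) Py∷d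
      (subst (N <_) (sym (ℕP.+-suc fuel k)) N<)
    where
      Py∷d : ∀ j → P ((y ∷ d) j)
      Py∷d zero    = Py
      Py∷d (suc j) = Pd j

  enumerate : ∀ N → CardinalityBound N → Enumeration N
  enumerate N card≤ = enumerate-from card≤ (suc N) 0 (λ ()) (λ { {()} }) (λ ())
    (ℕP.m≤m+n (suc N) 0)

zipWith-++ : ∀ {A B C : Set} {m n} (f : A → B → C) (xs : Fin m → A) (ys : Fin n → A)
  (xs′ : Fin m → B) (ys′ : Fin n → B) l →
  f ((xs ++ ys) l) ((xs′ ++ ys′) l) ≡ ((λ j → f (xs j) (xs′ j)) ++ (λ j → f (ys j) (ys′ j))) l
zipWith-++ {m = m} f xs ys xs′ ys′ l with splitAt m l
... | inj₁ _ = refl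
... | inj₂ _ = refl

-- Formulas of L_log and their satisfaction

⊤ᶠ : ∀ {n} → Formula n
⊤ᶠ = f⊥ f⇒ f⊥

¬ᶠ_ : ∀ {n} → Formula n → Formula n
¬ᶠ φ = φ f⇒ f⊥

decᶠ : ∀ {n} {P : Set} → Dec P → Formula n
decᶠ (yes _) = ⊤ᶠ
decᶠ (no _)  = f⊥

⋀ : ∀ {n} k → (Fin k → Formula n) → Formula n
⋀ zero    φ = ⊤ᶠ
⋀ (suc k) φ = φ zero f∧ ⋀ k (λ j → φ (suc j))

∃ⁿ : ∀ k {n} → Formula (k ℕ.+ n) → Formula n
∃ⁿ zero    φ = φ
∃ⁿ (suc k) φ = ∃ⁿ k (f∃ φ)

natMulᵗ : ∀ {n} → ℕ → Term n → Term n
natMulᵗ zero    t = t𝟘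
natMulᵗ (suc k) t = tadd t (natMulᵗ k t)

zMulᵗ : ∀ {n} → ℤ → Term n → Term n
zMulᵗ (+ k)    t = natMulᵗ k t
zMulᵗ -[1+ k ] t = tneg (natMulᵗ (suc k) t)

qMulᵗ : ∀ {n} → ℚ → Term n → Term n
qMulᵗ q t = tδ (ℚ.denominator-1 q) (zMulᵗ (ℚ.numerator q) t)

sumᵗ : ∀ {n k} → (Fin k → Term n) → Term n
sumᵗ {k = zero}  t = t𝟘
sumᵗ {k = suc k} t = tadd (t zero) (sumᵗ (λ j → t (suc j)))

module _ (M : LlogStr) where
  open LlogStr M

  eval-qMulᵗ : ∀ {n} (e : Fin n → Car) q t → eval M e (qMulᵗ q t) ≡ qMul M q (eval M e t)
  eval-qMulᵗ e q t = cong (δ _) (eval-zMulᵗ (ℚ.numerator q))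
    where
      eval-natMulᵗ : ∀ k → eval M e (natMulᵗ k t) ≡ natMul M k (eval M e t)
      eval-natMulᵗ zero    = refl
      eval-natMulᵗ (suc k) = cong (eval M e t ⊕_) (eval-natMulᵗ k)
      eval-zMulᵗ : ∀ N → eval M e (zMulᵗ N t) ≡ zMul M N (eval M e t)
      eval-zMulᵗ (+ k)    = eval-natMulᵗ k
      eval-zMulᵗ -[1+ k ] = cong ⊝_ (eval-natMulᵗ (suc k))

  sumFin-cong : ∀ {n} {f h : Fin n → Car} → (∀ i → f i ≡ h i) → sumFin M f ≡ sumFin M h
  sumFin-cong {zero}  f≗h = refl
  sumFin-cong {suc n} f≗h = cong₂ _⊕_ (f≗h zero) (sumFin-cong (λ i → f≗h (suc i)))

  eval-sumᵗ : ∀ {n k} (e : Fin n → Car) (t : Fin k → Term n) →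
    eval M e (sumᵗ t) ≡ sumFin M (λ j → eval M e (t j))
  eval-sumᵗ {k = zero}  e t = refl
  eval-sumᵗ {k = suc k} e t = cong (eval M e (t zero) ⊕_) (eval-sumᵗ e (λ j → t (suc j)))

  -- The environment seen by the body of ∃ⁿ k: the witnesses ys come first.
  extendEnv : ∀ {k n} → (Fin k → Car) → (Fin n → Car) → Fin (k ℕ.+ n) → Car
  extendEnv {zero}  ys e = e
  extendEnv {suc k} ys e = ext M (ys zero) (extendEnv (λ j → ys (suc j)) e)

  extendEnv-↑ˡ : ∀ {k} n (ys : Fin k → Car) (e : Fin n → Car) j → extendEnv ys e (j ↑ˡ n) ≡ ys j
  extendEnv-↑ˡ n ys e zero    = refl
  extendEnv-↑ˡ n ys e (suc j) = extendEnv-↑ˡ n (λ j → ys (suc j)) e j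

  extendEnv-↑ʳ : ∀ k {n} (ys : Fin k → Car) (e : Fin n → Car) i → extendEnv ys e (k ↑ʳ i) ≡ e i
  extendEnv-↑ʳ zero    ys e i = refl
  extendEnv-↑ʳ (suc k) ys e i = extendEnv-↑ʳ k (λ j → ys (suc j)) e i

  module _ (D : Car → Set) where

    decᶠ-sat : ∀ {n P} (P? : Dec P) (e : Fin n → Car) → SatIn M D (decᶠ P?) e ⇔ P
    decᶠ-sat (yes p) e = mk⇔ (λ _ → p) (λ _ → id)
    decᶠ-sat (no ¬p) e = mk⇔ ⊥-elim ¬p

    ⋀-sat : ∀ {n} k (φ : Fin k → Formula n) (e : Fin n → Car) →
      SatIn M D (⋀ k φ) e ⇔ (∀ j → SatIn M D (φ j) e)
    ⋀-sat zero    φ e = mk⇔ (λ _ ()) (λ _ → id)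
    ⋀-sat (suc k) φ e = mk⇔
      (λ { (h , hs) zero → h ; (h , hs) (suc j) → Equivalence.to (⋀-sat k _ e) hs j })
      (λ h → h zero , Equivalence.from (⋀-sat k _ e) (λ j → h (suc j)))

    ∃ⁿ-sat : ∀ k {n} (φ : Formula (k ℕ.+ n)) (e : Fin n → Car) →
      SatIn M D (∃ⁿ k φ) e ⇔ Σ (Fin k → Car) λ ys → (∀ j → D (ys j)) × SatIn M D φ (extendEnv ys e)
    ∃ⁿ-sat zero    φ e = mk⇔ (λ s → (λ ()) , (λ ()) , s) (λ (_ , _ , s) → s)
    ∃ⁿ-sat (suc k) φ e = mk⇔
      (λ s → let (ys , Dys , y , Dy , s′) = Equivalence.to (∃ⁿ-sat k (f∃ φ) e) s
             in (y ∷ ys) , (λ { zero → Dy ; (suc j) → Dys j }) , s′)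
      (λ (ys , Dys , s) → Equivalence.from (∃ⁿ-sat k (f∃ φ) e)
         ((λ j → ys (suc j)) , (λ j → Dys (suc j)) , ys zero , Dys zero , s))

module Representations (M : LlogStr) where
  open LlogStr M

  Representation : ∀ {K} → (Fin K → ℚ) → Car → (Fin K → Car) → Set
  Representation r g ys =
    (∀ j → p (ys j) ≢ ∞) × Injective _≡_ _≡_ ys × g ≡ sumFin M (λ j → qMul M (r j) (ys j))

  representationᶠ : ∀ K → (Fin K → ℚ) → Formula (K ℕ.+ 1)
  representationᶠ K r =
    ⋀ K (λ j → ¬ᶠ (tp (y j) ≐ t∞)) f∧
    (⋀ K (λ j → ⋀ K λ j′ → (y j ≐ y j′) f⇒ decᶠ (j FinP.≟ j′)) f∧
     (var (K ↑ʳ zero) ≐ sumᵗ (λ j → qMulᵗ (r j) (y j))))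
    where
      y : Fin K → Term (K ℕ.+ 1)
      y j = var (j ↑ˡ 1)

  representationᶠ-sat : ∀ D K r g (ys : Fin K → Car) →
    SatIn M D (representationᶠ K r) (extendEnv M ys (λ _ → g)) ⇔ Representation r g ys
  representationᶠ-sat D K r g ys = mk⇔
    (λ (dom , inj , sum) →
        (λ j pj≡∞ → Equivalence.to (⋀-sat M D K _ ρ) dom j (subst (λ u → p u ≡ ∞) (sym (ρ-ys j)) pj≡∞))
      , (λ {j} {j′} eq → Equivalence.to (decᶠ-sat M D (j FinP.≟ j′) ρ)
           (Equivalence.to (⋀-sat M D K _ ρ) (Equivalence.to (⋀-sat M D K _ ρ) inj j) j′
             (trans (ρ-ys j) (trans eq (sym (ρ-ys j′))))))
      , trans (sym ρ-g) (trans sum ρ-sum))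
    (λ (dom , inj , sum) →
        Equivalence.from (⋀-sat M D K _ ρ) (λ j pj≡∞ → dom j (subst (λ u → p u ≡ ∞) (ρ-ys j) pj≡∞))
      , Equivalence.from (⋀-sat M D K _ ρ) (λ j → Equivalence.from (⋀-sat M D K _ ρ) λ j′ eq →
           Equivalence.from (decᶠ-sat M D (j FinP.≟ j′) ρ) (inj (trans (sym (ρ-ys j)) (trans eq (ρ-ys j′)))))
      , trans ρ-g (trans sum (sym ρ-sum)))
    where
      ρ = extendEnv M ys (λ _ → g)
      ρ-ys : ∀ j → ρ (j ↑ˡ 1) ≡ ys j
      ρ-ys = extendEnv-↑ˡ M 1 ys (λ _ → g)
      ρ-g : ρ (K ↑ʳ zero) ≡ g
      ρ-g = extendEnv-↑ʳ M K ys (λ _ → g) zero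
      ρ-sum : eval M ρ (sumᵗ (λ j → qMulᵗ (r j) (var (j ↑ˡ 1)))) ≡ sumFin M (λ j → qMul M (r j) (ys j))
      ρ-sum = trans (eval-sumᵗ M ρ (λ j → qMulᵗ (r j) (var (j ↑ˡ 1)))) (sumFin-cong M (λ j → trans (eval-qMulᵗ M ρ (r j) (var (j ↑ˡ 1))) (cong (qMul M (r j)) (ρ-ys j))))

  representation-in-G₀ : (G₀ : Car → Set) → IsElementarySubstructure M G₀ →
    ∀ {K} (r : Fin K → ℚ) g (ys : Fin K → Car) → G₀ g → Representation r g ys →
    Σ (Fin K → Car) λ ys′ → (∀ j → G₀ (ys′ j)) × Representation r g ys′
  representation-in-G₀ G₀ (_ , elementary) {K} r g ys G₀g rep =
    let (ys′ , G₀ys′ , sat) = Equivalence.to (∃ⁿ-sat M G₀ K _ (λ _ → g)) satG₀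
    in ys′ , G₀ys′ , Equivalence.to (representationᶠ-sat G₀ K r g ys′) sat
    where
      satM : SatIn M (λ _ → ⊤) (∃ⁿ K (representationᶠ K r)) (λ _ → g)
      satM = Equivalence.from (∃ⁿ-sat M _ K _ (λ _ → g))
        (ys , (λ _ → tt) , Equivalence.from (representationᶠ-sat _ K r g ys) rep)
      satG₀ : SatIn M G₀ (∃ⁿ K (representationᶠ K r)) (λ _ → g)
      satG₀ = Equivalence.from (elementary (∃ⁿ K (representationᶠ K r)) (λ _ → g) (λ _ → G₀g)) satM

-- The ordered ℚ-vector space Γ

↥↧-+ : ∀ q r → (+ ↧ₙ r ℤ.* ↥ q ℤ.+ + ↧ₙ q ℤ.* ↥ r) ℤ.* ↧ (q ℚ.+ r) ≡ ↥ (q ℚ.+ r) ℤ.* + (↧ₙ q ℕ.* ↧ₙ r)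
↥↧-+ q@(ℚ.mkℚ _ _ _) r@(ℚ.mkℚ _ _ _) with ℚP.toℚᵘ-homo-+ q r
... | ℚᵘ.*≡* eq = trans (reorder (↥ q) (↥ r) (↧ q) (↧ r) (↧ (q ℚ.+ r))) (sym
  (subst₂ (λ a b → a ℤ.* + (↧ₙ q ℕ.* ↧ₙ r) ≡ (↥ q ℤ.* ↧ r ℤ.+ ↥ r ℤ.* ↧ q) ℤ.* b)
          (ℚP.↥ᵘ-toℚᵘ (q ℚ.+ r)) (ℚP.↧ᵘ-toℚᵘ (q ℚ.+ r)) eq))
  where
    reorder : ∀ a b c d e → (d ℤ.* a ℤ.+ c ℤ.* b) ℤ.* e ≡ (a ℤ.* d ℤ.+ b ℤ.* c) ℤ.* e
    reorder = solve 5 (λ a b c d e → (d :* a :+ c :* b) :* e := (a :* d :+ b :* c) :* e) refl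
      where open ℤ-Solver.+-*-Solver

↥↧-* : ∀ q r → (↥ q ℤ.* ↥ r) ℤ.* ↧ (q ℚ.* r) ≡ ↥ (q ℚ.* r) ℤ.* + (↧ₙ q ℕ.* ↧ₙ r)
↥↧-* q@(ℚ.mkℚ _ _ _) r@(ℚ.mkℚ _ _ _) with ℚP.toℚᵘ-homo-* q r
... | ℚᵘ.*≡* eq = sym
  (subst₂ (λ a b → a ℤ.* + (↧ₙ q ℕ.* ↧ₙ r) ≡ (↥ q ℤ.* ↥ r) ℤ.* b)
          (ℚP.↥ᵘ-toℚᵘ (q ℚ.* r)) (ℚP.↧ᵘ-toℚᵘ (q ℚ.* r)) eq)

module Arithmetic (M : LlogStr) (T : IsTlog M) where
  open LlogStr M
  open IsTlog T

  Γ : Car → Set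
  Γ = InΓ M

  Γ-abelianGroup : AbelianGroup 0ℓ 0ℓ
  Γ-abelianGroup = record
    { Carrier = Σ Car Γ
    ; _≈_     = λ x y → proj₁ x ≡ proj₁ y
    ; _∙_     = λ (x , gx) (y , gy) → x ⊕ y , ⊕-Γ x y gx gy
    ; ε       = 𝟘 , 𝟘-Γ
    ; _⁻¹     = λ (x , gx) → ⊝ x , ⊝-Γ x gx
    ; isAbelianGroup = record
      { isGroup = record
        { isMonoid = record
          { isSemigroup = record
            { isMagma = record
              { isEquivalence = record { refl = refl ; sym = sym ; trans = trans }
              ; ∙-cong = cong₂ _⊕_ }
            ; assoc = λ (x , gx) (y , gy) (z , gz) → ⊕-assoc x y z gx gy gz }
          ; identity = (λ (x , gx) → trans (⊕-comm 𝟘 x 𝟘-Γ gx) (⊕-idʳ x gx))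
                     , (λ (x , gx) → ⊕-idʳ x gx) }
        ; inverse = (λ (x , gx) → trans (⊕-comm (⊝ x) x (⊝-Γ x gx) gx) (⊕-invʳ x gx))
                  , (λ (x , gx) → ⊕-invʳ x gx)
        ; ⁻¹-cong = cong ⊝_ }
      ; comm = λ (x , gx) (y , gy) → ⊕-comm x y gx gy } }

  private
    module G = AbelianGroup Γ-abelianGroup
    module GP = AbelianGroupProperties Γ-abelianGroup
    module SP = CommutativeSemigroupProperties G.commutativeSemigroup

  ⊕-identityˡ : ∀ x → Γ x → 𝟘 ⊕ x ≡ x
  ⊕-identityˡ x gx = G.identityˡ (x , gx)

  ⊕-inverseˡ : ∀ x → Γ x → (⊝ x) ⊕ x ≡ 𝟘
  ⊕-inverseˡ x gx = G.inverseˡ (x , gx)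

  ⊕-interchange : ∀ a b c d → Γ a → Γ b → Γ c → Γ d → (a ⊕ b) ⊕ (c ⊕ d) ≡ (a ⊕ c) ⊕ (b ⊕ d)
  ⊕-interchange a b c d ga gb gc gd = SP.interchange (a , ga) (b , gb) (c , gc) (d , gd)

  ⊝-unique : ∀ x y → Γ x → Γ y → x ⊕ y ≡ 𝟘 → y ≡ ⊝ x
  ⊝-unique x y gx gy = GP.inverseʳ-unique (x , gx) (y , gy)

  ⊝-involutive : ∀ x → Γ x → ⊝ (⊝ x) ≡ x
  ⊝-involutive x gx = GP.⁻¹-involutive (x , gx)

  ⊝-𝟘 : ⊝ 𝟘 ≡ 𝟘
  ⊝-𝟘 = GP.ε⁻¹≈ε

  ⊝-distrib-⊕ : ∀ x y → Γ x → Γ y → ⊝ (x ⊕ y) ≡ (⊝ x) ⊕ (⊝ y)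
  ⊝-distrib-⊕ x y gx gy = sym (GP.⁻¹-∙-comm (x , gx) (y , gy))

  ⊝-≢𝟘 : ∀ x → Γ x → x ≢ 𝟘 → ⊝ x ≢ 𝟘
  ⊝-≢𝟘 x gx x≢𝟘 eq = x≢𝟘 (GP.⁻¹-injective {x , gx} {𝟘 , 𝟘-Γ} (trans eq (sym ⊝-𝟘)))

  ⊕⊝≡𝟘⇒≡ : ∀ x y → Γ x → Γ y → x ⊕ (⊝ y) ≡ 𝟘 → x ≡ y
  ⊕⊝≡𝟘⇒≡ x y gx gy = GP.x∙y⁻¹≈ε⇒x≈y (x , gx) (y , gy)

  ⊕⊝-cancel : ∀ x y → Γ x → Γ y → (x ⊕ y) ⊕ (⊝ y) ≡ x
  ⊕⊝-cancel x y gx gy = GP.//-rightDividesʳ (y , gy) (x , gx)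

  ≺-⊕ˡ : ∀ x y z → Γ x → Γ y → Γ z → x ≺ y → (z ⊕ x) ≺ (z ⊕ y)
  ≺-⊕ˡ x y z gx gy gz x≺y =
    subst₂ _≺_ (⊕-comm x z gx gz) (⊕-comm y z gy gz) (≺-⊕ x y z gx gy gz x≺y)

  nM : ℕ → Car → Car
  nM = natMul M

  nM-Γ : ∀ n x → Γ x → Γ (nM n x)
  nM-Γ zero    x gx = 𝟘-Γ
  nM-Γ (suc n) x gx = ⊕-Γ x _ gx (nM-Γ n x gx)

  nM-+ : ∀ a b x → Γ x → nM (a ℕ.+ b) x ≡ nM a x ⊕ nM b x
  nM-+ zero    b x gx = sym (⊕-identityˡ _ (nM-Γ b x gx))
  nM-+ (suc a) b x gx = trans (cong (x ⊕_) (nM-+ a b x gx))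
    (sym (⊕-assoc x _ _ gx (nM-Γ a x gx) (nM-Γ b x gx)))

  nM-* : ∀ a b x → Γ x → nM (a ℕ.* b) x ≡ nM a (nM b x)
  nM-* zero    b x gx = refl
  nM-* (suc a) b x gx = trans (nM-+ b (a ℕ.* b) x gx) (cong (nM b x ⊕_) (nM-* a b x gx))

  nM-𝟘 : ∀ a → nM a 𝟘 ≡ 𝟘
  nM-𝟘 zero    = refl
  nM-𝟘 (suc a) = trans (cong (𝟘 ⊕_) (nM-𝟘 a)) (⊕-idʳ 𝟘 𝟘-Γ)

  nM-⊕ : ∀ a x y → Γ x → Γ y → nM a (x ⊕ y) ≡ nM a x ⊕ nM a y
  nM-⊕ zero    x y gx gy = sym (⊕-idʳ 𝟘 𝟘-Γ)
  nM-⊕ (suc a) x y gx gy = trans (cong ((x ⊕ y) ⊕_) (nM-⊕ a x y gx gy))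
    (⊕-interchange x y (nM a x) (nM a y) gx gy (nM-Γ a x gx) (nM-Γ a y gy))

  nM-suc-strictMono : ∀ n x y → Γ x → Γ y → x ≺ y → nM (suc n) x ≺ nM (suc n) y
  nM-suc-strictMono zero    x y gx gy x≺y =
    subst₂ _≺_ (sym (⊕-idʳ x gx)) (sym (⊕-idʳ y gy)) x≺y
  nM-suc-strictMono (suc n) x y gx gy x≺y = ≺-trans _ _ _
    (≺-⊕ x y _ gx gy (nM-Γ (suc n) x gx) x≺y)
    (≺-⊕ˡ _ _ y (nM-Γ (suc n) x gx) (nM-Γ (suc n) y gy) gy (nM-suc-strictMono n x y gx gy x≺y))

  nM-suc-injective : ∀ n x y → Γ x → Γ y → nM (suc n) x ≡ nM (suc n) y → x ≡ y
  nM-suc-injective n x y gx gy eq with ≺-tri x y gx gy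
  ... | inj₁ x≺y        = ⊥-elim (≺-irrefl _ (subst (_≺ nM (suc n) y) eq (nM-suc-strictMono n x y gx gy x≺y)))
  ... | inj₂ (inj₁ x≡y) = x≡y
  ... | inj₂ (inj₂ y≺x) = ⊥-elim (≺-irrefl _ (subst (nM (suc n) y ≺_) eq (nM-suc-strictMono n y x gy gx y≺x)))

  zM : ℤ → Car → Car
  zM = zMul M

  zM-Γ : ∀ N x → Γ x → Γ (zM N x)
  zM-Γ (+ n)    x gx = nM-Γ n x gx
  zM-Γ -[1+ n ] x gx = ⊝-Γ _ (nM-Γ (suc n) x gx)

  zM-⊖ : ∀ a b x → Γ x → zM (a ⊖ b) x ≡ nM a x ⊕ (⊝ nM b x)
  zM-⊖ a       zero    x gx = sym (trans (cong (nM a x ⊕_) ⊝-𝟘) (⊕-idʳ _ (nM-Γ a x gx)))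
  zM-⊖ zero    (suc b) x gx = sym (⊕-identityˡ _ (⊝-Γ _ (nM-Γ (suc b) x gx)))
  zM-⊖ (suc a) (suc b) x gx = begin
    zM (suc a ⊖ suc b) x        ≡⟨ cong (λ N → zM N x) (ℤP.[1+m]⊖[1+n]≡m⊖n a b) ⟩
    zM (a ⊖ b) x                ≡⟨ zM-⊖ a b x gx ⟩
    A ⊕ (⊝ B)                   ≡⟨ sym (⊕-identityˡ _ (⊕-Γ _ _ gA (⊝-Γ _ gB))) ⟩
    𝟘 ⊕ (A ⊕ (⊝ B))             ≡⟨ cong (_⊕ (A ⊕ (⊝ B))) (sym (⊕-invʳ x gx)) ⟩
    (x ⊕ (⊝ x)) ⊕ (A ⊕ (⊝ B))   ≡⟨ ⊕-interchange x (⊝ x) A (⊝ B) gx (⊝-Γ x gx) gA (⊝-Γ _ gB) ⟩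
    (x ⊕ A) ⊕ ((⊝ x) ⊕ (⊝ B))   ≡⟨ cong ((x ⊕ A) ⊕_) (sym (⊝-distrib-⊕ x B gx gB)) ⟩
    (x ⊕ A) ⊕ (⊝ (x ⊕ B))       ∎
    where
      open ≡-Reasoning
      A = nM a x
      B = nM b x
      gA = nM-Γ a x gx
      gB = nM-Γ b x gx

  zM-+ : ∀ K N x → Γ x → zM (K ℤ.+ N) x ≡ zM K x ⊕ zM N x
  zM-+ (+ m)    (+ n)    x gx = nM-+ m n x gx
  zM-+ (+ m)    -[1+ n ] x gx = zM-⊖ m (suc n) x gx
  zM-+ -[1+ m ] (+ n)    x gx =
    trans (zM-⊖ n (suc m) x gx) (⊕-comm _ _ (nM-Γ n x gx) (⊝-Γ _ (nM-Γ (suc m) x gx)))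
  zM-+ -[1+ m ] -[1+ n ] x gx = begin
    ⊝ nM (suc (suc (m ℕ.+ n))) x        ≡⟨ cong (λ k → ⊝ nM (suc k) x) (sym (ℕP.+-suc m n)) ⟩
    ⊝ nM (suc m ℕ.+ suc n) x            ≡⟨ cong ⊝_ (nM-+ (suc m) (suc n) x gx) ⟩
    ⊝ (nM (suc m) x ⊕ nM (suc n) x)     ≡⟨ ⊝-distrib-⊕ _ _ (nM-Γ (suc m) x gx) (nM-Γ (suc n) x gx) ⟩
    (⊝ nM (suc m) x) ⊕ (⊝ nM (suc n) x) ∎
    where open ≡-Reasoning

  zM-neg : ∀ N x → Γ x → zM (ℤ.- N) x ≡ ⊝ zM N x
  zM-neg (+ zero)  x gx = sym ⊝-𝟘
  zM-neg (+ suc n) x gx = refl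
  zM-neg -[1+ n ]  x gx = sym (⊝-involutive _ (nM-Γ (suc n) x gx))

  zM-+* : ∀ a N x → Γ x → zM (+ a ℤ.* N) x ≡ nM a (zM N x)
  zM-+* zero    N x gx = cong (λ K → zM K x) (ℤP.*-zeroˡ N)
  zM-+* (suc a) N x gx = begin
    zM (+ suc a ℤ.* N) x      ≡⟨ cong (λ K → zM K x) (ℤP.suc-* (+ a) N) ⟩
    zM (N ℤ.+ + a ℤ.* N) x    ≡⟨ zM-+ N (+ a ℤ.* N) x gx ⟩
    zM N x ⊕ zM (+ a ℤ.* N) x ≡⟨ cong (zM N x ⊕_) (zM-+* a N x gx) ⟩
    zM N x ⊕ nM a (zM N x)    ∎
    where open ≡-Reasoning

  zM-* : ∀ K N x → Γ x → zM (K ℤ.* N) x ≡ zM K (zM N x)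
  zM-* (+ a)    N x gx = zM-+* a N x gx
  zM-* -[1+ a ] N x gx = begin
    zM (-[1+ a ] ℤ.* N) x      ≡⟨ cong (λ K → zM K x) (ℤP.neg-distribˡ-* (+ suc a) N) ⟨
    zM (ℤ.- (+ suc a ℤ.* N)) x ≡⟨ zM-neg (+ suc a ℤ.* N) x gx ⟩
    ⊝ zM (+ suc a ℤ.* N) x     ≡⟨ cong ⊝_ (zM-+* (suc a) N x gx) ⟩
    ⊝ nM (suc a) (zM N x)      ∎
    where open ≡-Reasoning

  zM-⊕ : ∀ N x y → Γ x → Γ y → zM N (x ⊕ y) ≡ zM N x ⊕ zM N y
  zM-⊕ (+ n)    x y gx gy = nM-⊕ n x y gx gy
  zM-⊕ -[1+ n ] x y gx gy = trans (cong ⊝_ (nM-⊕ (suc n) x y gx gy))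
    (⊝-distrib-⊕ _ _ (nM-Γ (suc n) x gx) (nM-Γ (suc n) y gy))

  zM-𝟘 : ∀ N → zM N 𝟘 ≡ 𝟘
  zM-𝟘 (+ n)    = nM-𝟘 n
  zM-𝟘 -[1+ n ] = trans (cong ⊝_ (nM-𝟘 (suc n))) ⊝-𝟘

  nM-zM-comm : ∀ a N x → Γ x → nM a (zM N x) ≡ zM N (nM a x)
  nM-zM-comm a N x gx = begin
    nM a (zM N x)    ≡⟨ zM-* (+ a) N x gx ⟨
    zM (+ a ℤ.* N) x ≡⟨ cong (λ K → zM K x) (ℤP.*-comm (+ a) N) ⟩
    zM (N ℤ.* + a) x ≡⟨ zM-* N (+ a) x gx ⟩
    zM N (nM a x)    ∎
    where open ≡-Reasoning

  qM : ℚ → Car → Car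
  qM = qMul M

  qM-Γ : ∀ q x → Γ x → Γ (qM q x)
  qM-Γ q x gx = δ-Γ _ _ (zM-Γ (↥ q) x gx)

  ↧·qM : ∀ q x → Γ x → nM (↧ₙ q) (qM q x) ≡ zM (↥ q) x
  ↧·qM q x gx = δ-div _ _ (zM-Γ (↥ q) x gx)

  qM-unique : ∀ q x y a N → Γ x → Γ y → nM (suc a) y ≡ zM N x →
    N ℤ.* ↧ q ≡ ↥ q ℤ.* + suc a → y ≡ qM q x
  qM-unique q x y a N gx gy a·y≡N·x N/a≡q =
    nM-suc-injective (ℕ.pred (D ℕ.* suc a)) y (qM q x) gy (qM-Γ q x gx) (begin
      nM (D ℕ.* suc a) y            ≡⟨ nM-* D (suc a) y gy ⟩
      nM D (nM (suc a) y)           ≡⟨ cong (nM D) a·y≡N·x ⟩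
      nM D (zM N x)                 ≡⟨ zM-* (+ D) N x gx ⟨
      zM (+ D ℤ.* N) x              ≡⟨ cong (λ K → zM K x) cross ⟩
      zM (+ suc a ℤ.* ↥ q) x        ≡⟨ zM-* (+ suc a) (↥ q) x gx ⟩
      nM (suc a) (zM (↥ q) x)       ≡⟨ cong (nM (suc a)) (↧·qM q x gx) ⟨
      nM (suc a) (nM D (qM q x))    ≡⟨ nM-* (suc a) D (qM q x) (qM-Γ q x gx) ⟨
      nM (suc a ℕ.* D) (qM q x)     ≡⟨ cong (λ k → nM k (qM q x)) (ℕP.*-comm (suc a) D) ⟩
      nM (D ℕ.* suc a) (qM q x)     ∎)
    where
      open ≡-Reasoning
      D = ↧ₙ q
      cross : + D ℤ.* N ≡ + suc a ℤ.* ↥ q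
      cross = trans (ℤP.*-comm (+ D) N) (trans N/a≡q (ℤP.*-comm (↥ q) (+ suc a)))

  qM-distribʳ-+ : ∀ q r x → Γ x → qM (q ℚ.+ r) x ≡ qM q x ⊕ qM r x
  qM-distribʳ-+ q r x gx = sym (qM-unique (q ℚ.+ r) x (qM q x ⊕ qM r x) (ℕ.pred (Dq ℕ.* Dr))
      (+ Dr ℤ.* ↥ q ℤ.+ + Dq ℤ.* ↥ r) gx (⊕-Γ _ _ gA gB) cleared (↥↧-+ q r))
    where
      open ≡-Reasoning
      Dq = ↧ₙ q
      Dr = ↧ₙ r
      A = qM q x
      B = qM r x
      gA = qM-Γ q x gx
      gB = qM-Γ r x gx
      cleared : nM (Dq ℕ.* Dr) (A ⊕ B) ≡ zM (+ Dr ℤ.* ↥ q ℤ.+ + Dq ℤ.* ↥ r) x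
      cleared = begin
        nM (Dq ℕ.* Dr) (A ⊕ B)                    ≡⟨ nM-⊕ (Dq ℕ.* Dr) A B gA gB ⟩
        nM (Dq ℕ.* Dr) A ⊕ nM (Dq ℕ.* Dr) B       ≡⟨ cong₂ _⊕_ (trans (cong (λ k → nM k A) (ℕP.*-comm Dq Dr))
                                                                       (nM-* Dr Dq A gA))
                                                              (nM-* Dq Dr B gB) ⟩
        nM Dr (nM Dq A) ⊕ nM Dq (nM Dr B)         ≡⟨ cong₂ _⊕_ (cong (nM Dr) (↧·qM q x gx)) (cong (nM Dq) (↧·qM r x gx)) ⟩
        nM Dr (zM (↥ q) x) ⊕ nM Dq (zM (↥ r) x)   ≡⟨ cong₂ _⊕_ (zM-+* Dr (↥ q) x gx) (zM-+* Dq (↥ r) x gx) ⟨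
        zM (+ Dr ℤ.* ↥ q) x ⊕ zM (+ Dq ℤ.* ↥ r) x ≡⟨ zM-+ (+ Dr ℤ.* ↥ q) (+ Dq ℤ.* ↥ r) x gx ⟨
        zM (+ Dr ℤ.* ↥ q ℤ.+ + Dq ℤ.* ↥ r) x      ∎

  qM-assoc : ∀ q r x → Γ x → qM q (qM r x) ≡ qM (q ℚ.* r) x
  qM-assoc q r x gx = qM-unique (q ℚ.* r) x (qM q (qM r x)) (ℕ.pred (Dq ℕ.* Dr))
      (↥ q ℤ.* ↥ r) gx (qM-Γ q _ gB) cleared (↥↧-* q r)
    where
      open ≡-Reasoning
      Dq = ↧ₙ q
      Dr = ↧ₙ r
      B = qM r x
      gB = qM-Γ r x gx
      cleared : nM (Dq ℕ.* Dr) (qM q B) ≡ zM (↥ q ℤ.* ↥ r) x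
      cleared = begin
        nM (Dq ℕ.* Dr) (qM q B) ≡⟨ cong (λ k → nM k (qM q B)) (ℕP.*-comm Dq Dr) ⟩
        nM (Dr ℕ.* Dq) (qM q B) ≡⟨ nM-* Dr Dq _ (qM-Γ q B gB) ⟩
        nM Dr (nM Dq (qM q B))  ≡⟨ cong (nM Dr) (↧·qM q B gB) ⟩
        nM Dr (zM (↥ q) B)      ≡⟨ nM-zM-comm Dr (↥ q) B gB ⟩
        zM (↥ q) (nM Dr B)      ≡⟨ cong (zM (↥ q)) (↧·qM r x gx) ⟩
        zM (↥ q) (zM (↥ r) x)   ≡⟨ zM-* (↥ q) (↥ r) x gx ⟨
        zM (↥ q ℤ.* ↥ r) x      ∎

  δ-unique : ∀ k x y → Γ x → Γ y → nM (suc k) y ≡ x → y ≡ δ k x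
  δ-unique k x y gx gy eq = nM-suc-injective k y (δ k x) gy (δ-Γ k x gx) (trans eq (sym (δ-div k x gx)))

  qM-distribˡ-⊕ : ∀ q x y → Γ x → Γ y → qM q (x ⊕ y) ≡ qM q x ⊕ qM q y
  qM-distribˡ-⊕ q x y gx gy = sym (δ-unique _ _ _ (zM-Γ (↥ q) _ (⊕-Γ x y gx gy))
    (⊕-Γ _ _ (qM-Γ q x gx) (qM-Γ q y gy))
    (trans (nM-⊕ (↧ₙ q) _ _ (qM-Γ q x gx) (qM-Γ q y gy))
      (trans (cong₂ _⊕_ (↧·qM q x gx) (↧·qM q y gy)) (sym (zM-⊕ (↥ q) x y gx gy)))))

  qM-𝟘 : ∀ q → qM q 𝟘 ≡ 𝟘
  qM-𝟘 q = trans (cong (δ _) (zM-𝟘 (↥ q))) (sym (δ-unique _ 𝟘 𝟘 𝟘-Γ 𝟘-Γ (nM-𝟘 (↧ₙ q))))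

  qM-0ℚ : ∀ x → qM 0ℚ x ≡ 𝟘
  qM-0ℚ x = sym (δ-unique 0 𝟘 𝟘 𝟘-Γ 𝟘-Γ (⊕-idʳ 𝟘 𝟘-Γ))

  qM-1ℚ : ∀ x → Γ x → qM 1ℚ x ≡ x
  qM-1ℚ x gx = sym (δ-unique 0 (x ⊕ 𝟘) x (⊕-Γ x 𝟘 gx 𝟘-Γ) gx refl)

  qM-neg : ∀ q x → Γ x → qM (ℚ.- q) x ≡ ⊝ qM q x
  qM-neg q x gx = ⊝-unique (qM q x) (qM (ℚ.- q) x) (qM-Γ q x gx) (qM-Γ (ℚ.- q) x gx) (begin
    qM q x ⊕ qM (ℚ.- q) x ≡⟨ qM-distribʳ-+ q (ℚ.- q) x gx ⟨
    qM (q ℚ.+ ℚ.- q) x    ≡⟨ cong (λ u → qM u x) (ℚP.+-inverseʳ q) ⟩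
    qM 0ℚ x               ≡⟨ qM-0ℚ x ⟩
    𝟘                     ∎)
    where open ≡-Reasoning

  ∑ : ∀ {n} → (Fin n → Car) → Car
  ∑ = sumFin M

  ∑-Γ : ∀ {n} (f : Fin n → Car) → (∀ i → Γ (f i)) → Γ (∑ f)
  ∑-Γ {zero}  f gf = 𝟘-Γ
  ∑-Γ {suc n} f gf = ⊕-Γ _ _ (gf zero) (∑-Γ (λ i → f (suc i)) (λ i → gf (suc i)))

  ∑-cong : ∀ {n} {f g : Fin n → Car} → (∀ i → f i ≡ g i) → ∑ f ≡ ∑ g
  ∑-cong = sumFin-cong M

  ∑-𝟘 : ∀ {n} (f : Fin n → Car) → (∀ i → f i ≡ 𝟘) → ∑ f ≡ 𝟘
  ∑-𝟘 {zero}  f f≡𝟘 = refl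
  ∑-𝟘 {suc n} f f≡𝟘 =
    trans (cong₂ _⊕_ (f≡𝟘 zero) (∑-𝟘 (λ i → f (suc i)) (λ i → f≡𝟘 (suc i)))) (⊕-idʳ 𝟘 𝟘-Γ)

  ∑-single : ∀ {n} (f : Fin n → Car) (l : Fin n) → (∀ i → Γ (f i)) →
    (∀ i → i ≢ l → f i ≡ 𝟘) → ∑ f ≡ f l
  ∑-single f zero    gf others =
    trans (cong (f zero ⊕_) (∑-𝟘 _ (λ i → others (suc i) (λ ())))) (⊕-idʳ _ (gf zero))
  ∑-single f (suc l) gf others = begin
    f zero ⊕ ∑ (λ i → f (suc i)) ≡⟨ cong (_⊕ ∑ (λ i → f (suc i))) (others zero (λ ())) ⟩
    𝟘 ⊕ ∑ (λ i → f (suc i))      ≡⟨ ⊕-identityˡ _ (∑-Γ _ (λ i → gf (suc i))) ⟩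
    ∑ (λ i → f (suc i))          ≡⟨ ∑-single (λ i → f (suc i)) l (λ i → gf (suc i))
                                     (λ i i≢l → others (suc i) (λ eq → i≢l (FinP.suc-injective eq))) ⟩
    f (suc l)                    ∎
    where open ≡-Reasoning

  ∑-distrib-⊕ : ∀ {n} (f g : Fin n → Car) → (∀ i → Γ (f i)) → (∀ i → Γ (g i)) →
    ∑ (λ i → f i ⊕ g i) ≡ ∑ f ⊕ ∑ g
  ∑-distrib-⊕ {zero}  f g gf gg = sym (⊕-idʳ 𝟘 𝟘-Γ)
  ∑-distrib-⊕ {suc n} f g gf gg =
    trans (cong ((f zero ⊕ g zero) ⊕_) (∑-distrib-⊕ f′ g′ (λ i → gf (suc i)) (λ i → gg (suc i))))
      (⊕-interchange _ _ _ _ (gf zero) (gg zero) (∑-Γ f′ (λ i → gf (suc i))) (∑-Γ g′ (λ i → gg (suc i))))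
    where
      f′ = λ i → f (suc i)
      g′ = λ i → g (suc i)

  ∑-⊝ : ∀ {n} (f : Fin n → Car) → (∀ i → Γ (f i)) → ∑ (λ i → ⊝ f i) ≡ ⊝ ∑ f
  ∑-⊝ {zero}  f gf = sym ⊝-𝟘
  ∑-⊝ {suc n} f gf = trans (cong ((⊝ f zero) ⊕_) (∑-⊝ (λ i → f (suc i)) (λ i → gf (suc i))))
    (sym (⊝-distrib-⊕ _ _ (gf zero) (∑-Γ (λ i → f (suc i)) (λ i → gf (suc i)))))

  ∑-comm : ∀ m n (h : Fin m → Fin n → Car) → (∀ j i → Γ (h j i)) →
    ∑ (λ j → ∑ (λ i → h j i)) ≡ ∑ (λ i → ∑ (λ j → h j i))
  ∑-comm zero    n h gh = sym (∑-𝟘 {n} (λ i → 𝟘) (λ i → refl))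
  ∑-comm (suc m) n h gh =
    trans (cong (∑ (h zero) ⊕_) (∑-comm m n (λ j → h (suc j)) (λ j → gh (suc j))))
      (sym (∑-distrib-⊕ (h zero) (λ i → ∑ (λ j → h (suc j) i)) (gh zero)
        (λ i → ∑-Γ _ (λ j → gh (suc j) i))))

  ∑-++ : ∀ m {n} (f : Fin m → Car) (g : Fin n → Car) → (∀ i → Γ (f i)) → (∀ i → Γ (g i)) →
    ∑ (f ++ g) ≡ ∑ f ⊕ ∑ g
  ∑-++ zero    f g gf gg = sym (⊕-identityˡ _ (∑-Γ g gg))
  ∑-++ (suc m) f g gf gg = begin
    f zero ⊕ ∑ (λ i → (f ++ g) (suc i))      ≡⟨ cong (f zero ⊕_) (∑-cong (λ i → [,]-map (splitAt m i))) ⟩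
    f zero ⊕ ∑ ((λ i → f (suc i)) ++ g)      ≡⟨ cong (f zero ⊕_) (∑-++ m _ g (λ i → gf (suc i)) gg) ⟩
    f zero ⊕ (∑ (λ i → f (suc i)) ⊕ ∑ g)     ≡⟨ ⊕-assoc _ _ _ (gf zero) (∑-Γ _ (λ i → gf (suc i))) (∑-Γ g gg) ⟨
    (f zero ⊕ ∑ (λ i → f (suc i))) ⊕ ∑ g     ∎
    where open ≡-Reasoning

  qM-distrib-∑ : ∀ {n} q (f : Fin n → Car) → (∀ i → Γ (f i)) → qM q (∑ f) ≡ ∑ (λ i → qM q (f i))
  qM-distrib-∑ {zero}  q f gf = qM-𝟘 q
  qM-distrib-∑ {suc n} q f gf =
    trans (qM-distribˡ-⊕ q _ _ (gf zero) (∑-Γ (λ i → f (suc i)) (λ i → gf (suc i))))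
      (cong (qM q (f zero) ⊕_) (qM-distrib-∑ q (λ i → f (suc i)) (λ i → gf (suc i))))

  ∑-qM-distribʳ : ∀ {n} (t : Fin n → ℚ) x → Γ x → ∑ (λ i → qM (t i) x) ≡ qM (∑ℚ t) x
  ∑-qM-distribʳ {zero}  t x gx = sym (qM-0ℚ x)
  ∑-qM-distribʳ {suc n} t x gx = trans (cong (qM (t zero) x ⊕_) (∑-qM-distribʳ (λ i → t (suc i)) x gx))
    (sym (qM-distribʳ-+ (t zero) _ x gx))

  ⊕⊝-telescope : ∀ x y z → Γ x → Γ y → Γ z → (x ⊕ (⊝ y)) ⊕ (y ⊕ (⊝ z)) ≡ x ⊕ (⊝ z)
  ⊕⊝-telescope x y z gx gy gz =
    trans (⊕-assoc x (⊝ y) _ gx (⊝-Γ y gy) (⊕-Γ _ _ gy (⊝-Γ z gz)))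
      (cong (x ⊕_) (GP.\\-leftDividesʳ (y , gy) (⊝ z , ⊝-Γ z gz)))

  ∑-qM-++-neg : ∀ {K} (r : Fin K → ℚ) (x y : Fin K → Car) → (∀ j → Γ (x j)) → (∀ j → Γ (y j)) →
    ∑ (λ j → qM (r j) (x j)) ≡ ∑ (λ j → qM (r j) (y j)) →
    ∑ (λ l → qM ((r ++ (λ j → ℚ.- r j)) l) ((x ++ y) l)) ≡ 𝟘
  ∑-qM-++-neg {K} r x y gx gy ∑rx≡∑ry = begin
    ∑ (λ l → qM ((r ++ (λ j → ℚ.- r j)) l) ((x ++ y) l))
      ≡⟨ ∑-cong (zipWith-++ qM r (λ j → ℚ.- r j) x y) ⟩
    ∑ ((λ j → qM (r j) (x j)) ++ (λ j → qM (ℚ.- r j) (y j)))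
      ≡⟨ ∑-++ K _ _ (λ j → qM-Γ (r j) _ (gx j)) (λ j → qM-Γ (ℚ.- r j) _ (gy j)) ⟩
    ∑ (λ j → qM (r j) (x j)) ⊕ ∑ (λ j → qM (ℚ.- r j) (y j))
      ≡⟨ cong (_ ⊕_) (∑-cong (λ j → qM-neg (r j) (y j) (gy j))) ⟩
    ∑ (λ j → qM (r j) (x j)) ⊕ ∑ (λ j → ⊝ qM (r j) (y j))
      ≡⟨ cong (_ ⊕_) (trans (∑-⊝ _ (λ j → qM-Γ (r j) _ (gy j))) (cong ⊝_ (sym ∑rx≡∑ry))) ⟩
    ∑ (λ j → qM (r j) (x j)) ⊕ (⊝ ∑ (λ j → qM (r j) (x j)))
      ≡⟨ ⊕-invʳ _ (∑-Γ _ (λ j → qM-Γ (r j) _ (gx j))) ⟩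
    𝟘 ∎
    where open ≡-Reasoning

-- The map ψ

module Valuation (M : LlogStr) (T : IsTlog M) where
  open LlogStr M
  open IsTlog T
  open Arithmetic M T

  _⪯_ : Car → Car → Set
  _⪯_ = _≼_ M

  ≺-⪯-trans : ∀ {x y z} → x ≺ y → y ⪯ z → x ≺ z
  ≺-⪯-trans x≺y (inj₁ y≺z)  = ≺-trans _ _ _ x≺y y≺z
  ≺-⪯-trans x≺y (inj₂ refl) = x≺y

  ⪯-≺-trans : ∀ {x y z} → x ⪯ y → y ≺ z → x ≺ z
  ⪯-≺-trans (inj₁ x≺y)  y≺z = ≺-trans _ _ _ x≺y y≺z
  ⪯-≺-trans (inj₂ refl) y≺z = y≺z

  ⪯-trans : ∀ {x y z} → x ⪯ y → y ⪯ z → x ⪯ z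
  ⪯-trans (inj₁ x≺y)  y⪯z = inj₁ (≺-⪯-trans x≺y y⪯z)
  ⪯-trans (inj₂ refl) y⪯z = y⪯z

  ⪯-antisym : ∀ {x y} → x ⪯ y → y ⪯ x → x ≡ y
  ⪯-antisym (inj₂ x≡y)  _           = x≡y
  ⪯-antisym (inj₁ x≺y)  (inj₂ y≡x)  = sym y≡x
  ⪯-antisym (inj₁ x≺y)  (inj₁ y≺x)  = ⊥-elim (≺-irrefl _ (≺-trans _ _ _ x≺y y≺x))

  ≺⇒≢ : ∀ {x y} → x ≺ y → x ≢ y
  ≺⇒≢ x≺y refl = ≺-irrefl _ x≺y

  ⊀⇒⪯ : ∀ x y → Γ x → Γ y → ¬ (y ≺ x) → x ⪯ y
  ⊀⇒⪯ x y gx gy y⊀x with ≺-tri x y gx gy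
  ... | inj₁ x≺y        = inj₁ x≺y
  ... | inj₂ (inj₁ x≡y) = inj₂ x≡y
  ... | inj₂ (inj₂ y≺x) = ⊥-elim (y⊀x y≺x)

  ⋠⇒≻ : ∀ x y → Γ x → Γ y → ¬ (x ⪯ y) → y ≺ x
  ⋠⇒≻ x y gx gy x⋠y with ≺-tri x y gx gy
  ... | inj₁ x≺y        = ⊥-elim (x⋠y (inj₁ x≺y))
  ... | inj₂ (inj₁ x≡y) = ⊥-elim (x⋠y (inj₂ x≡y))
  ... | inj₂ (inj₂ y≺x) = y≺x

  ⊕-monoʳ-⪯ : ∀ x y z → Γ x → Γ y → Γ z → x ⪯ y → (z ⊕ x) ⪯ (z ⊕ y)
  ⊕-monoʳ-⪯ x y z gx gy gz (inj₁ x≺y)  = inj₁ (≺-⊕ˡ x y z gx gy gz x≺y)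
  ⊕-monoʳ-⪯ x y z gx gy gz (inj₂ refl) = inj₂ refl

  _≟𝟘 : ∀ {x} → Γ x → Dec (x ≡ 𝟘)
  _≟𝟘 {x} gx with ≺-tri x 𝟘 gx 𝟘-Γ
  ... | inj₁ x≺𝟘        = no (≺⇒≢ x≺𝟘)
  ... | inj₂ (inj₁ x≡𝟘) = yes x≡𝟘
  ... | inj₂ (inj₂ 𝟘≺x) = no (λ x≡𝟘 → ≺⇒≢ 𝟘≺x (sym x≡𝟘))

  ψ-⊝ : ∀ x → Γ x → x ≢ 𝟘 → ψ (⊝ x) ≡ ψ x
  ψ-⊝ x gx x≢𝟘 = trans (cong (λ u → ψ (⊝ u)) (sym (⊕-idʳ x gx))) (AC2 -[1+ 0 ] x gx x≢𝟘 (λ ()))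

  zM-≢𝟘 : ∀ N x → Γ x → x ≢ 𝟘 → N ≢ + 0 → zM N x ≢ 𝟘
  zM-≢𝟘 N x gx x≢𝟘 N≢0 N·x≡𝟘 =
    ψ-Γ x gx x≢𝟘 (trans (sym (AC2 N x gx x≢𝟘 N≢0)) (trans (cong ψ N·x≡𝟘) ψ-𝟘))

  qM-≢𝟘 : ∀ q x → Γ x → x ≢ 𝟘 → q ≢ 0ℚ → qM q x ≢ 𝟘
  qM-≢𝟘 q x gx x≢𝟘 q≢0 q·x≡𝟘 = zM-≢𝟘 (↥ q) x gx x≢𝟘 (λ ↥q≡0 → q≢0 (ℚP.↥p≡0⇒p≡0 q ↥q≡0))
    (trans (sym (↧·qM q x gx)) (trans (cong (nM (↧ₙ q)) q·x≡𝟘) (nM-𝟘 (↧ₙ q))))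

  ψ-qM : ∀ q x → Γ x → x ≢ 𝟘 → q ≢ 0ℚ → ψ (qM q x) ≡ ψ x
  ψ-qM q x gx x≢𝟘 q≢0 = begin
    ψ (qM q x)                  ≡⟨ AC2 (+ ↧ₙ q) (qM q x) (qM-Γ q x gx) (qM-≢𝟘 q x gx x≢𝟘 q≢0) (λ ()) ⟨
    ψ (nM (↧ₙ q) (qM q x))      ≡⟨ cong ψ (↧·qM q x gx) ⟩
    ψ (zM (↥ q) x)              ≡⟨ AC2 (↥ q) x gx x≢𝟘 (λ ↥q≡0 → q≢0 (ℚP.↥p≡0⇒p≡0 q ↥q≡0)) ⟩
    ψ x                         ∎
    where open ≡-Reasoning

  ψ-⊕-≺ : ∀ x c → Γ x → Γ c → x ≢ 𝟘 → c ≢ 𝟘 → ψ c ≺ ψ x → (x ⊕ c ≢ 𝟘) × ψ (x ⊕ c) ≡ ψ c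
  ψ-⊕-≺ x c gx gc x≢𝟘 c≢𝟘 ψc≺ψx = y≢𝟘 , ⪯-antisym ψy⪯ψc ψc⪯ψy
    where
      y = x ⊕ c
      gy = ⊕-Γ x c gx gc
      y≢𝟘 : y ≢ 𝟘
      y≢𝟘 y≡𝟘 = ≺⇒≢ ψc≺ψx (trans (cong ψ (⊝-unique x c gx gc y≡𝟘)) (ψ-⊝ x gx x≢𝟘))
      y⊝x : y ⊕ (⊝ x) ≡ c
      y⊝x = trans (cong (_⊕ (⊝ x)) (⊕-comm x c gx gc)) (⊕⊝-cancel c x gc gx)
      ψy⪯ψc : ψ y ⪯ ψ c
      ψy⪯ψc with AC1 y (⊝ x) gy (⊝-Γ x gx) y≢𝟘 (⊝-≢𝟘 x gx x≢𝟘) (λ eq → c≢𝟘 (trans (sym y⊝x) eq))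
      ... | inj₁ ψy⪯ = subst (ψ y ⪯_) (cong ψ y⊝x) ψy⪯
      ... | inj₂ ψ⊝x⪯ = ⊥-elim (≺-irrefl _ (≺-⪯-trans ψc≺ψx
              (subst₂ _⪯_ (ψ-⊝ x gx x≢𝟘) (cong ψ y⊝x) ψ⊝x⪯)))
      ψc⪯ψy : ψ c ⪯ ψ y
      ψc⪯ψy with AC1 x c gx gc x≢𝟘 c≢𝟘 y≢𝟘
      ... | inj₂ ψc⪯ = ψc⪯
      ... | inj₁ ψx⪯ = ⊥-elim (≺-irrefl _ (≺-⪯-trans ψc≺ψx (⪯-trans ψx⪯ ψy⪯ψc)))

  ψ-⊕-distinct : ∀ x y → Γ x → Γ y → x ≢ 𝟘 → y ≢ 𝟘 → ψ x ≢ ψ y →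
    (x ⊕ y ≢ 𝟘) × (ψ (x ⊕ y) ≡ ψ x ⊎ ψ (x ⊕ y) ≡ ψ y)
  ψ-⊕-distinct x y gx gy x≢𝟘 y≢𝟘 ψx≢ψy with ≺-tri (ψ x) (ψ y) (ψ-Γ x gx x≢𝟘) (ψ-Γ y gy y≢𝟘)
  ... | inj₁ ψx≺ψy =
    let (y⊕x≢𝟘 , ψy⊕x≡ψx) = ψ-⊕-≺ y x gy gx y≢𝟘 x≢𝟘 ψx≺ψy
        x⊕y≡y⊕x = ⊕-comm x y gx gy
    in (λ eq → y⊕x≢𝟘 (trans (sym x⊕y≡y⊕x) eq)) , inj₁ (trans (cong ψ x⊕y≡y⊕x) ψy⊕x≡ψx)
  ... | inj₂ (inj₁ ψx≡ψy) = ⊥-elim (ψx≢ψy ψx≡ψy)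
  ... | inj₂ (inj₂ ψy≺ψx) = let (x⊕y≢𝟘 , ψx⊕y≡ψy) = ψ-⊕-≺ x y gx gy x≢𝟘 y≢𝟘 ψy≺ψx in x⊕y≢𝟘 , inj₂ ψx⊕y≡ψy

  ψ-∑-distinct : ∀ {N} (a : Fin N → Car) → (∀ l → Γ (a l)) →
    (∀ l l′ → l ≢ l′ → a l ≢ 𝟘 → a l′ ≢ 𝟘 → ψ (a l) ≢ ψ (a l′)) →
    (∀ l → a l ≡ 𝟘) ⊎ ((∑ a ≢ 𝟘) × ∃ λ l → (a l ≢ 𝟘) × ψ (∑ a) ≡ ψ (a l))
  ψ-∑-distinct {zero}  a ga distinct = inj₁ (λ ())
  ψ-∑-distinct {suc N} a ga distinct with ga zero ≟𝟘
      | ψ-∑-distinct (λ l → a (suc l)) (λ l → ga (suc l))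
          (λ l l′ l≢l′ → distinct (suc l) (suc l′) (λ eq → l≢l′ (FinP.suc-injective eq)))
  ... | yes a₀≡𝟘 | inj₁ rest≡𝟘 = inj₁ λ { zero → a₀≡𝟘 ; (suc l) → rest≡𝟘 l }
  ... | no a₀≢𝟘  | inj₁ rest≡𝟘 = inj₂ ((λ eq → a₀≢𝟘 (trans (sym ∑≡a₀) eq)) , zero , a₀≢𝟘 , cong ψ ∑≡a₀)
    where
      ∑≡a₀ : ∑ a ≡ a zero
      ∑≡a₀ = trans (cong (a zero ⊕_) (∑-𝟘 _ rest≡𝟘)) (⊕-idʳ _ (ga zero))
  ... | yes a₀≡𝟘 | inj₂ (R≢𝟘 , l , al≢𝟘 , ψR≡) =
    inj₂ ((λ eq → R≢𝟘 (trans (sym ∑≡R) eq)) , suc l , al≢𝟘 , trans (cong ψ ∑≡R) ψR≡)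
    where
      ∑≡R : ∑ a ≡ ∑ (λ l → a (suc l))
      ∑≡R = trans (cong (_⊕ ∑ (λ l → a (suc l))) a₀≡𝟘) (⊕-identityˡ _ (∑-Γ _ (λ l → ga (suc l))))
  ... | no a₀≢𝟘  | inj₂ (R≢𝟘 , l , al≢𝟘 , ψR≡)
    with ψ-⊕-distinct (a zero) _ (ga zero) (∑-Γ _ (λ l → ga (suc l))) a₀≢𝟘 R≢𝟘
           (λ eq → distinct zero (suc l) (λ ()) a₀≢𝟘 al≢𝟘 (trans eq ψR≡))
  ...   | ∑≢𝟘 , inj₁ ψ∑≡ψa₀ = inj₂ (∑≢𝟘 , zero , a₀≢𝟘 , ψ∑≡ψa₀)
  ...   | ∑≢𝟘 , inj₂ ψ∑≡ψR  = inj₂ (∑≢𝟘 , suc l , al≢𝟘 , trans ψ∑≡ψR ψR≡)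

  Ψ : Car → Set
  Ψ = InΨ M

  Ψ-Γ : ∀ x → Ψ x → Γ x
  Ψ-Γ x (α , gα , α≢𝟘 , ψα≡x) = subst Γ ψα≡x (ψ-Γ α gα α≢𝟘)

  Ψ-positive : ∀ x → Ψ x → 𝟘 ≺ x
  Ψ-positive x Ψx = ≺-⪯-trans s0-pos (s0-least x Ψx)

  Ψ-≢𝟘 : ∀ x → Ψ x → x ≢ 𝟘
  Ψ-≢𝟘 x Ψx x≡𝟘 = ≺⇒≢ (Ψ-positive x Ψx) (sym x≡𝟘)

  -- s 0 = ψ (∫ 0) and ∫ 0 = - ψ (∫ 0), so ψ (s 0) = ψ (- ∫ 0) = s 0.
  ψ-s𝟘 : ψ (s 𝟘) ≡ s 𝟘
  ψ-s𝟘 with asInt 𝟘 𝟘-Γ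
  ... | a , ga , a≢𝟘 , a′≡𝟘 , s𝟘≡ψa =
    trans (cong ψ (trans s𝟘≡ψa (⊝-unique a (ψ a) ga (ψ-Γ a ga a≢𝟘) a′≡𝟘)))
      (trans (ψ-⊝ a ga a≢𝟘) (sym s𝟘≡ψa))

  ψ-Ψ-⪯-s𝟘 : ∀ x → Ψ x → ψ x ⪯ s 𝟘
  ψ-Ψ-⪯-s𝟘 x Ψx = subst (ψ x ⪯_) ψ-s𝟘
    (H-type (s 𝟘) x (Ψ-Γ _ s0-Ψ) (Ψ-Γ x Ψx) s0-pos (s0-least x Ψx))

  s-⪯ : ∀ α β → Ψ α → Ψ β → α ≺ β → s α ⪯ β
  s-⪯ α β Ψα Ψβ α≺β = ⊀⇒⪯ (s α) β (Ψ-Γ _ (s-Ψ α Ψα)) (Ψ-Γ β Ψβ) (s-imm α β Ψα Ψβ α≺β)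

  s-strictMono : ∀ α β → Ψ α → Ψ β → α ≺ β → s α ≺ s β
  s-strictMono α β Ψα Ψβ α≺β = ⪯-≺-trans (s-⪯ α β Ψα Ψβ α≺β) (s-succ β Ψβ)

  s-injective : ∀ α β → Ψ α → Ψ β → s α ≡ s β → α ≡ β
  s-injective α β Ψα Ψβ sα≡sβ with ≺-tri α β (Ψ-Γ α Ψα) (Ψ-Γ β Ψβ)
  ... | inj₁ α≺β        = ⊥-elim (≺⇒≢ (s-strictMono α β Ψα Ψβ α≺β) sα≡sβ)
  ... | inj₂ (inj₁ α≡β) = α≡β
  ... | inj₂ (inj₂ β≺α) = ⊥-elim (≺⇒≢ (s-strictMono β α Ψβ Ψα β≺α) (sym sα≡sβ))

  -- If ψ d ⪯ α for d = β - α > 0 then d + ψ d ⪯ β, against AC3 for d and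
  -- the witness of β ∈ Ψ.
  ≺-ψ-difference : ∀ α β → Ψ α → Ψ β → α ≺ β → α ≺ ψ (β ⊕ (⊝ α))
  ≺-ψ-difference α β Ψα Ψβ@(b , gb , b≢𝟘 , ψb≡β) α≺β =
    ⋠⇒≻ (ψ d) α (ψ-Γ d gd d≢𝟘) gα (λ ψd⪯α → ≺-irrefl β (≺-⪯-trans β≺d+ψd (d+ψd⪯β ψd⪯α)))
    where
      gα = Ψ-Γ α Ψα
      gβ = Ψ-Γ β Ψβ
      d = β ⊕ (⊝ α)
      gd = ⊕-Γ β (⊝ α) gβ (⊝-Γ α gα)
      d≢𝟘 : d ≢ 𝟘
      d≢𝟘 eq = ≺⇒≢ α≺β (sym (⊕⊝≡𝟘⇒≡ β α gβ gα eq))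
      𝟘≺d : 𝟘 ≺ d
      𝟘≺d = subst (_≺ d) (⊕-invʳ α gα) (≺-⊕ α β (⊝ α) gα gβ (⊝-Γ α gα) α≺β)
      β≺d+ψd : β ≺ (d ⊕ ψ d)
      β≺d+ψd = subst (_≺ (d ⊕ ψ d)) ψb≡β (AC3 d b gd gb b≢𝟘 𝟘≺d)
      d+α≡β : d ⊕ α ≡ β
      d+α≡β = trans (⊕-assoc β (⊝ α) α gβ (⊝-Γ α gα) gα)
        (trans (cong (β ⊕_) (⊕-inverseˡ α gα)) (⊕-idʳ β gβ))
      d+ψd⪯β : ψ d ⪯ α → (d ⊕ ψ d) ⪯ β
      d+ψd⪯β ψd⪯α = subst ((d ⊕ ψ d) ⪯_) d+α≡β (⊕-monoʳ-⪯ (ψ d) α d (ψ-Γ d gd d≢𝟘) gα gd ψd⪯α)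

  -- With a = ∫ α we have s α - α = - a, whose ψ-value is ψ a = s α.
  ψ-s⊝ : ∀ α → Γ α → (s α ⊕ (⊝ α) ≢ 𝟘) × ψ (s α ⊕ (⊝ α)) ≡ s α
  ψ-s⊝ α gα with asInt α gα
  ... | a , ga , a≢𝟘 , a′≡α , sα≡ψa =
    subst (λ e → (e ≢ 𝟘) × ψ e ≡ s α) (sym sα⊝α≡⊝a)
      (⊝-≢𝟘 a ga a≢𝟘 , trans (ψ-⊝ a ga a≢𝟘) (sym sα≡ψa))
    where
      gψa = ψ-Γ a ga a≢𝟘
      sα⊝α≡⊝a : s α ⊕ (⊝ α) ≡ ⊝ a
      sα⊝α≡⊝a = trans (cong (_⊕ (⊝ α)) sα≡ψa) (⊝-unique a (ψ a ⊕ (⊝ α)) ga (⊕-Γ _ _ gψa (⊝-Γ α gα))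
        (trans (sym (⊕-assoc a (ψ a) (⊝ α) ga gψa (⊝-Γ α gα)))
          (trans (cong (_⊕ (⊝ α)) a′≡α) (⊕-invʳ α gα))))

  ψ-Ψ-difference : ∀ α β → Ψ α → Ψ β → α ≺ β → (β ⊕ (⊝ α) ≢ 𝟘) × ψ (β ⊕ (⊝ α)) ≡ s α
  ψ-Ψ-difference α β Ψα Ψβ α≺β with s-⪯ α β Ψα Ψβ α≺β
  ... | inj₂ refl = ψ-s⊝ α gα
    where gα = Ψ-Γ α Ψα
  ... | inj₁ sα≺β =
    subst (λ e → (e ≢ 𝟘) × ψ e ≡ s α) (⊕⊝-telescope β (s α) α gβ gsα gα)
      (proj₁ sum , trans (proj₂ sum) ψe≡sα)
    where
      gα = Ψ-Γ α Ψα
      gβ = Ψ-Γ β Ψβ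
      gsα = Ψ-Γ _ (s-Ψ α Ψα)
      x = β ⊕ (⊝ s α)
      e = s α ⊕ (⊝ α)
      gx = ⊕-Γ β _ gβ (⊝-Γ _ gsα)
      x≢𝟘 : x ≢ 𝟘
      x≢𝟘 eq = ≺⇒≢ sα≺β (sym (⊕⊝≡𝟘⇒≡ β (s α) gβ gsα eq))
      ψe≡sα = proj₂ (ψ-s⊝ α gα)
      sum = ψ-⊕-≺ x e gx (⊕-Γ _ _ gsα (⊝-Γ α gα)) x≢𝟘 (proj₁ (ψ-s⊝ α gα))
              (subst (_≺ ψ x) (sym ψe≡sα) (≺-ψ-difference (s α) β (s-Ψ α Ψα) Ψβ sα≺β))

  maximum : ∀ {N} (z : Fin (suc N) → Car) → (∀ l → Γ (z l)) → ∃ λ l₀ → ∀ l → z l ⪯ z l₀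
  maximum {zero}  z gz = zero , λ { zero → inj₂ refl }
  maximum {suc N} z gz with maximum (λ l → z (suc l)) (λ l → gz (suc l))
  ... | l₁ , z⪯zl₁ with ≺-tri (z zero) (z (suc l₁)) (gz zero) (gz (suc l₁))
  ...   | inj₁ z₀≺        = suc l₁ , λ { zero → inj₁ z₀≺ ; (suc l) → z⪯zl₁ l }
  ...   | inj₂ (inj₁ z₀≡) = suc l₁ , λ { zero → inj₂ z₀≡ ; (suc l) → z⪯zl₁ l }
  ...   | inj₂ (inj₂ ≺z₀) = zero , λ { zero → inj₂ refl ; (suc l) → inj₁ (⪯-≺-trans (z⪯zl₁ l) ≺z₀) }

  -- Subtracting the largest element B turns Σ t_l z_l = 0 into a sum
  -- Σ t_l (z_l - B) = (Σ t_l)(- B) whose nonzero terms have the distinct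
  -- ψ-values s (z_l); since ψ B ≤ s 0 < s (z_l), every term must vanish.
  module Independence {N} (z : Fin (suc N) → Car) (z-injective : Injective _≡_ _≡_ z)
                      (zΨ : ∀ l → Ψ (z l)) (t : Fin (suc N) → ℚ)
                      (∑tz≡𝟘 : ∑ (λ l → qM (t l) (z l)) ≡ 𝟘) where
    gz : ∀ l → Γ (z l)
    gz l = Ψ-Γ _ (zΨ l)

    B = z (proj₁ (maximum z gz))
    z⪯B = proj₂ (maximum z gz)
    ΨB = zΨ (proj₁ (maximum z gz))
    gB = gz (proj₁ (maximum z gz))
    g⊝B = ⊝-Γ B gB

    d : Fin (suc N) → Car
    d l = z l ⊕ (⊝ B)

    gd : ∀ l → Γ (d l)
    gd l = ⊕-Γ _ _ (gz l) g⊝B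

    a : Fin (suc N) → Car
    a l = qM (t l) (d l)

    ga : ∀ l → Γ (a l)
    ga l = qM-Γ (t l) (d l) (gd l)

    d-below : ∀ l → z l ≺ B → (d l ≢ 𝟘) × ψ (d l) ≡ s (z l)
    d-below l zl≺B = (λ eq → proj₁ diff (trans (sym (⊝-involutive _ g)) (trans (cong ⊝_ (trans (sym d≡) eq)) ⊝-𝟘)))
                   , trans (cong ψ d≡) (trans (ψ-⊝ _ g (proj₁ diff)) (proj₂ diff))
      where
        diff = ψ-Ψ-difference (z l) B (zΨ l) ΨB zl≺B
        g = ⊕-Γ B _ gB (⊝-Γ _ (gz l))
        d≡ : d l ≡ ⊝ (B ⊕ (⊝ z l))
        d≡ = trans (cong (_⊕ (⊝ B)) (sym (⊝-involutive _ (gz l))))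
          (trans (⊕-comm _ _ (⊝-Γ _ (⊝-Γ _ (gz l))) g⊝B) (sym (⊝-distrib-⊕ B (⊝ z l) gB (⊝-Γ _ (gz l)))))

    a-≢𝟘 : ∀ l → a l ≢ 𝟘 → (z l ≺ B) × ψ (a l) ≡ s (z l)
    a-≢𝟘 l al≢𝟘 = zl≺B , trans (ψ-qM (t l) (d l) (gd l) (proj₁ (d-below l zl≺B)) tl≢0) (proj₂ (d-below l zl≺B))
      where
        tl≢0 : t l ≢ 0ℚ
        tl≢0 eq = al≢𝟘 (trans (cong (λ u → qM u (d l)) eq) (qM-0ℚ (d l)))
        zl≺B : z l ≺ B
        zl≺B with z⪯B l
        ... | inj₁ zl≺B = zl≺B
        ... | inj₂ zl≡B = ⊥-elim (al≢𝟘 (trans (cong (qM (t l)) (trans (cong (_⊕ (⊝ B)) zl≡B) (⊕-invʳ B gB))) (qM-𝟘 (t l))))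

    a-distinct : ∀ l l′ → l ≢ l′ → a l ≢ 𝟘 → a l′ ≢ 𝟘 → ψ (a l) ≢ ψ (a l′)
    a-distinct l l′ l≢l′ al≢𝟘 al′≢𝟘 eq = l≢l′ (z-injective (s-injective (z l) (z l′) (zΨ l) (zΨ l′)
      (trans (sym (proj₂ (a-≢𝟘 l al≢𝟘))) (trans eq (proj₂ (a-≢𝟘 l′ al′≢𝟘))))))

    ∑a : ∑ a ≡ qM (∑ℚ t) (⊝ B)
    ∑a = begin
      ∑ a                                                   ≡⟨ ∑-cong (λ l → qM-distribˡ-⊕ (t l) (z l) (⊝ B) (gz l) g⊝B) ⟩
      ∑ (λ l → qM (t l) (z l) ⊕ qM (t l) (⊝ B))             ≡⟨ ∑-distrib-⊕ _ _ (λ l → qM-Γ (t l) _ (gz l)) (λ l → qM-Γ (t l) _ g⊝B) ⟩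
      ∑ (λ l → qM (t l) (z l)) ⊕ ∑ (λ l → qM (t l) (⊝ B))   ≡⟨ cong₂ _⊕_ ∑tz≡𝟘 (∑-qM-distribʳ t (⊝ B) g⊝B) ⟩
      𝟘 ⊕ qM (∑ℚ t) (⊝ B)                                   ≡⟨ ⊕-identityˡ _ (qM-Γ (∑ℚ t) _ g⊝B) ⟩
      qM (∑ℚ t) (⊝ B)                                       ∎
      where open ≡-Reasoning

    a≡𝟘 : ∀ l → a l ≡ 𝟘
    a≡𝟘 with ψ-∑-distinct a ga a-distinct
    ... | inj₁ a≡𝟘 = a≡𝟘
    ... | inj₂ (∑a≢𝟘 , l , al≢𝟘 , ψ∑a≡) with ∑ℚ t ℚP.≟ 0ℚ
    ...   | yes T≡0 = ⊥-elim (∑a≢𝟘 (trans ∑a (trans (cong (λ u → qM u (⊝ B)) T≡0) (qM-0ℚ (⊝ B)))))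
    ...   | no T≢0 = ⊥-elim (≺⇒≢ ψB≺szl (begin
      ψ B                    ≡⟨ ψ-⊝ B gB (Ψ-≢𝟘 B ΨB) ⟨
      ψ (⊝ B)                ≡⟨ ψ-qM (∑ℚ t) (⊝ B) g⊝B (⊝-≢𝟘 B gB (Ψ-≢𝟘 B ΨB)) T≢0 ⟨
      ψ (qM (∑ℚ t) (⊝ B))    ≡⟨ cong ψ ∑a ⟨
      ψ (∑ a)                ≡⟨ ψ∑a≡ ⟩
      ψ (a l)                ≡⟨ proj₂ (a-≢𝟘 l al≢𝟘) ⟩
      s (z l)                ∎))
      where
        open ≡-Reasoning
        ψB≺szl : ψ B ≺ s (z l)
        ψB≺szl = ⪯-≺-trans (ψ-Ψ-⪯-s𝟘 B ΨB) (⪯-≺-trans (s0-least (z l) (zΨ l)) (s-succ (z l) (zΨ l)))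

    t≢0⇒z≡B : ∀ l → t l ≢ 0ℚ → z l ≡ B
    t≢0⇒z≡B l tl≢0 with z⪯B l
    ... | inj₂ zl≡B = zl≡B
    ... | inj₁ zl≺B = ⊥-elim (qM-≢𝟘 (t l) (d l) (gd l) (proj₁ (d-below l zl≺B)) tl≢0 (a≡𝟘 l))

    t≡0 : ∀ l → t l ≡ 0ℚ
    t≡0 l₀ with t l₀ ℚP.≟ 0ℚ
    ... | yes tl₀≡0 = tl₀≡0
    ... | no tl₀≢0 = ⊥-elim (qM-≢𝟘 (t l₀) (z l₀) (gz l₀) (Ψ-≢𝟘 _ (zΨ l₀)) tl₀≢0
      (trans (sym (∑-single _ l₀ (λ l → qM-Γ (t l) _ (gz l)) others)) ∑tz≡𝟘))
      where
        others : ∀ l → l ≢ l₀ → qM (t l) (z l) ≡ 𝟘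
        others l l≢l₀ with t l ℚP.≟ 0ℚ
        ... | yes tl≡0 = trans (cong (λ u → qM u (z l)) tl≡0) (qM-0ℚ (z l))
        ... | no tl≢0  = ⊥-elim (l≢l₀ (z-injective (trans (t≢0⇒z≡B l tl≢0) (sym (t≢0⇒z≡B l₀ tl₀≢0)))))

  Ψ-linearlyIndependent : ∀ {N} (z : Fin N → Car) → Injective _≡_ _≡_ z → (∀ l → Ψ (z l)) →
    (t : Fin N → ℚ) → ∑ (λ l → qM (t l) (z l)) ≡ 𝟘 → ∀ l → t l ≡ 0ℚ
  Ψ-linearlyIndependent {suc N} z z-inj zΨ t ∑tz≡𝟘 = Independence.t≡0 z z-inj zΨ t ∑tz≡𝟘

module Proposition (em : ExcludedMiddle 0ℓ) (M : LlogStr) (T : IsTlog M)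
                   (G₀ : LlogStr.Car M → Set) (G₀≼M : IsElementarySubstructure M G₀)
                   {m : ℕ} (c : Fin m → LlogStr.Car M) (c-Γ : ∀ i → InΓ M (c i)) where
  open LlogStr M
  open IsTlog T
  open Arithmetic M T
  open Valuation M T
  open Representations M
  open IsSubstructure (proj₁ G₀≼M)

  G₀-qM : ∀ q x → G₀ x → G₀ (qM q x)
  G₀-qM q x G₀x = δ∈ _ _ (G₀-zM (ℚ.numerator q))
    where
      G₀-nM : ∀ n → G₀ (nM n x)
      G₀-nM zero    = 𝟘∈
      G₀-nM (suc n) = ⊕∈ _ _ G₀x (G₀-nM n)
      G₀-zM : ∀ N → G₀ (zM N x)
      G₀-zM (ℤ.+ n)    = G₀-nM n
      G₀-zM ℤ.-[1+ n ] = ⊝∈ _ (G₀-nM (suc n))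

  G₀-∑ : ∀ {n} (f : Fin n → Car) → (∀ i → G₀ (f i)) → G₀ (∑ f)
  G₀-∑ {zero}  f G₀f = 𝟘∈
  G₀-∑ {suc n} f G₀f = ⊕∈ _ _ (G₀f zero) (G₀-∑ (λ i → f (suc i)) (λ i → G₀f (suc i)))

  p-defined⇒Ψ : ∀ y → p y ≢ ∞ → Ψ y
  p-defined⇒Ψ y py≢∞ = proj₁ (decidable-stable em (λ y∉dom → py≢∞ (p-else y y∉dom)))

  ∑-qM-eliminate : ∀ {K} (r : Fin K → ℚ) (g : Fin K → Car) (q : Fin K → Fin m → ℚ) →
    (∀ j → Γ (g j)) → (∀ i → ∑ℚ (λ j → r j ℚ.* q j i) ≡ 0ℚ) →
    ∑ (λ j → qM (r j) (g j ⊕ ∑ (λ i → qM (q j i) (c i)))) ≡ ∑ (λ j → qM (r j) (g j))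
  ∑-qM-eliminate {K} r g q gg r-kills = begin
    ∑ (λ j → qM (r j) (g j ⊕ C j))
      ≡⟨ ∑-cong (λ j → qM-distribˡ-⊕ (r j) (g j) (C j) (gg j) (gC j)) ⟩
    ∑ (λ j → qM (r j) (g j) ⊕ qM (r j) (C j))
      ≡⟨ ∑-distrib-⊕ _ _ (λ j → qM-Γ (r j) _ (gg j)) (λ j → qM-Γ (r j) _ (gC j)) ⟩
    ∑ (λ j → qM (r j) (g j)) ⊕ ∑ (λ j → qM (r j) (C j))
      ≡⟨ cong (∑ (λ j → qM (r j) (g j)) ⊕_) ∑rC≡𝟘 ⟩
    ∑ (λ j → qM (r j) (g j)) ⊕ 𝟘
      ≡⟨ ⊕-idʳ _ (∑-Γ _ (λ j → qM-Γ (r j) _ (gg j))) ⟩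
    ∑ (λ j → qM (r j) (g j)) ∎
    where
      open ≡-Reasoning
      C : Fin K → Car
      C j = ∑ (λ i → qM (q j i) (c i))
      gC : ∀ j → Γ (C j)
      gC j = ∑-Γ _ (λ i → qM-Γ (q j i) _ (c-Γ i))
      ∑rC≡𝟘 : ∑ (λ j → qM (r j) (C j)) ≡ 𝟘
      ∑rC≡𝟘 = begin
        ∑ (λ j → qM (r j) (C j))
          ≡⟨ ∑-cong (λ j → trans (qM-distrib-∑ (r j) _ (λ i → qM-Γ (q j i) _ (c-Γ i)))
                               (∑-cong (λ i → qM-assoc (r j) (q j i) (c i) (c-Γ i)))) ⟩
        ∑ (λ j → ∑ (λ i → qM (r j ℚ.* q j i) (c i)))
          ≡⟨ ∑-comm K m _ (λ j i → qM-Γ (r j ℚ.* q j i) _ (c-Γ i)) ⟩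
        ∑ (λ i → ∑ (λ j → qM (r j ℚ.* q j i) (c i)))
          ≡⟨ ∑-cong (λ i → trans (∑-qM-distribʳ (λ j → r j ℚ.* q j i) (c i) (c-Γ i))
                               (trans (cong (λ u → qM u (c i)) (r-kills i)) (qM-0ℚ (c i)))) ⟩
        ∑ {m} (λ _ → 𝟘)
          ≡⟨ ∑-𝟘 {m} _ (λ _ → refl) ⟩
        𝟘 ∎

  no-new-family : (x g : Fin (suc m) → Car) (q : Fin (suc m) → Fin m → ℚ) →
    Injective _≡_ _≡_ x → (∀ j → x j ≡ g j ⊕ ∑ (λ i → qM (q j i) (c i))) →
    (∀ j → G₀ (g j)) → (∀ j → Γ (g j)) → (∀ j → p (x j) ≢ ∞) → (∀ j → ¬ G₀ (x j)) → ⊥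
  no-new-family x g q x-inj x≡ G₀g gg x-dom x∉G₀ with rows-dependent m q
  ... | r , (j₀ , rj₀≢0) , r-kills =
    realised-in-G₀ (representation-in-G₀ G₀ G₀≼M r (∑ (λ j → qM (r j) (g j))) x
      (G₀-∑ _ (λ j → G₀-qM (r j) _ (G₀g j))) (x-dom , x-inj , sym ∑rx≡∑rg))
    where
      ∑rx≡∑rg : ∑ (λ j → qM (r j) (x j)) ≡ ∑ (λ j → qM (r j) (g j))
      ∑rx≡∑rg = trans (∑-cong (λ j → cong (qM (r j)) (x≡ j))) (∑-qM-eliminate r g q gg r-kills)
      xΨ = λ j → p-defined⇒Ψ _ (x-dom j)
      realised-in-G₀ : Σ (Fin (suc m) → Car) (λ y → (∀ j → G₀ (y j)) ×
                         Representation r (∑ (λ j → qM (r j) (g j))) y) → ⊥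
      realised-in-G₀ (y , G₀y , y-dom , y-inj , ∑rg≡∑ry) =
        rj₀≢0 (trans (sym (lookup-++ˡ r (λ j → ℚ.- r j) j₀))
          (Ψ-linearlyIndependent (x ++ y) x++y-inj (++⁺ Ψ xΨ yΨ) (r ++ (λ j → ℚ.- r j))
            (∑-qM-++-neg r x y (λ j → Ψ-Γ _ (xΨ j)) (λ j → Ψ-Γ _ (yΨ j)) (trans ∑rx≡∑rg ∑rg≡∑ry))
            (j₀ ↑ˡ suc m)))
        where
          yΨ = λ j → p-defined⇒Ψ _ (y-dom j)
          x++y-inj : Injective _≡_ _≡_ (x ++ y)
          x++y-inj = ++-injective x y x-inj y-inj (λ i j xi≡yj → x∉G₀ i (subst G₀ (sym xi≡yj) (G₀y j)))

  ∞∈pΓ₀ : InPΓ₀ M G₀ c ∞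
  ∞∈pΓ₀ = 𝟘 , 𝟘∈ , 𝟘-Γ , p-else 𝟘 (λ (Ψ𝟘 , _) → Ψ-≢𝟘 𝟘 Ψ𝟘 refl)

  new-Γ : ∀ y → InNew M G₀ c y → Γ y
  new-Γ y (_ , y∉pΓ₀) y≡∞ = y∉pΓ₀ (subst (InPΓ₀ M G₀ c) (sym y≡∞) ∞∈pΓ₀)

  new-card≤m : NewCard≤ M G₀ c m
  new-card≤m k d d-inj d-new with k ℕ.≤? m
  ... | yes k≤m = k≤m
  ... | no k≰m = ⊥-elim (no-new-family x g q x-inj x≡ G₀g gg x-dom x∉G₀)
    where
      ι : Fin (suc m) → Fin k
      ι j = inject≤ j (ℕP.≰⇒> k≰m)
      preimage = λ j → proj₁ (d-new (ι j))
      x = λ j → proj₁ (preimage j)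
      x-ext = λ j → proj₁ (proj₂ (preimage j))
      px≡d = λ j → proj₂ (proj₂ (preimage j))
      g = λ j → proj₁ (x-ext j)
      G₀g = λ j → proj₁ (proj₂ (x-ext j))
      gg = λ j → proj₁ (proj₂ (proj₂ (x-ext j)))
      q = λ j → proj₁ (proj₂ (proj₂ (proj₂ (x-ext j))))
      x≡ = λ j → proj₂ (proj₂ (proj₂ (proj₂ (x-ext j))))
      x-inj : Injective _≡_ _≡_ x
      x-inj {j} {j′} xj≡xj′ = FinP.inject≤-injective _ _ j j′
        (d-inj (trans (sym (px≡d j)) (trans (cong p xj≡xj′) (px≡d j′))))
      x-dom : ∀ j → p (x j) ≢ ∞
      x-dom j = subst (_≢ ∞) (sym (px≡d j)) (new-Γ _ (d-new (ι j)))
      x∉G₀ : ∀ j → ¬ G₀ (x j)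
      x∉G₀ j G₀x = proj₂ (d-new (ι j)) (x j , G₀x , subst Γ (sym (x≡ j))
        (⊕-Γ _ _ (gg j) (∑-Γ _ (λ i → qM-Γ (q j i) _ (c-Γ i)))) , px≡d j)

  module _ {n} (d : Fin n → Car) (d-new : ∀ j → InNew M G₀ c (d j)) where

    old⇒span : ∀ y → Γ y → InPΓ₀ M G₀ c y → InSpan M G₀ c d y
    old⇒span y gy y∈pΓ₀ = 1 , (λ _ → y) , (λ _ → y∈pΓ₀ , gy) , (λ _ → 1ℚ) , (λ _ → 0ℚ) , sym (begin
      (qM 1ℚ y ⊕ 𝟘) ⊕ ∑ (λ j → qM 0ℚ (d j)) ≡⟨ cong₂ _⊕_ (⊕-idʳ _ (qM-Γ 1ℚ y gy)) (∑-𝟘 _ (λ j → qM-0ℚ (d j))) ⟩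
      qM 1ℚ y ⊕ 𝟘                           ≡⟨ ⊕-idʳ _ (qM-Γ 1ℚ y gy) ⟩
      qM 1ℚ y                               ≡⟨ qM-1ℚ y gy ⟩
      y                                     ∎)
      where open ≡-Reasoning

    member⇒span : ∀ j → InSpan M G₀ c d (d j)
    member⇒span j = 0 , (λ ()) , (λ ()) , (λ ()) , indicator , sym (begin
      𝟘 ⊕ ∑ (λ l → qM (indicator l) (d l)) ≡⟨ ⊕-identityˡ _ (∑-Γ _ (λ l → qM-Γ (indicator l) _ (gd l))) ⟩
      ∑ (λ l → qM (indicator l) (d l))     ≡⟨ ∑-single _ j (λ l → qM-Γ (indicator l) _ (gd l)) off-j ⟩
      qM (indicator j) (d j)               ≡⟨ at-j ⟩
      d j                                  ∎)
      where
        open ≡-Reasoning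
        gd = λ l → new-Γ _ (d-new l)
        indicator : Fin n → ℚ
        indicator l with l FinP.≟ j
        ... | yes _ = 1ℚ
        ... | no _  = 0ℚ
        off-j : ∀ l → l ≢ j → qM (indicator l) (d l) ≡ 𝟘
        off-j l l≢j with l FinP.≟ j
        ... | yes l≡j = ⊥-elim (l≢j l≡j)
        ... | no _    = qM-0ℚ (d l)
        at-j : qM (indicator j) (d j) ≡ d j
        at-j with j FinP.≟ j
        ... | yes _   = qM-1ℚ (d j) (gd j)
        ... | no j≢j  = ⊥-elim (j≢j refl)

    spans : (∀ y → InNew M G₀ c y → ∃ λ j → d j ≡ y) →
      ∀ y → InPExt M G₀ c y → y ≡ ∞ ⊎ InSpan M G₀ c d y
    spans d-covers y y∈pExt with em {y ≡ ∞} | em {InPΓ₀ M G₀ c y}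
    ... | yes y≡∞ | _          = inj₁ y≡∞
    ... | no y≢∞  | yes y∈pΓ₀  = inj₂ (old⇒span y y≢∞ y∈pΓ₀)
    ... | no y≢∞  | no y∉pΓ₀   with d-covers y (y∈pExt , y∉pΓ₀)
    ...   | j , dj≡y = inj₂ (subst (InSpan M G₀ c d) dj≡y (member⇒span j))

  new-card≤1+m : NewCard≤ M G₀ c (suc m)
  new-card≤1+m k d d-inj d-new = ℕP.m≤n⇒m≤1+n (new-card≤m k d d-inj d-new)

  spanning-enumeration : Σ ℕ λ n → n ≤ suc m × Σ (Fin n → Car) λ d →
    Injective _≡_ _≡_ d × (∀ j → InNew M G₀ c (d j)) ×
    (∀ y → InPExt M G₀ c y → y ≡ ∞ ⊎ InSpan M G₀ c d y)
  spanning-enumeration with enumerate em (InNew M G₀ c) (suc m) new-card≤1+m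
  ... | n , n≤1+m , d , d-inj , d-new , d-covers =
    n , n≤1+m , d , d-inj , d-new , spans d d-new d-covers

proposition6p4 : ExcludedMiddle 0ℓ →
    (M : LlogStr) → IsTlog M →
    (G₀ : LlogStr.Car M → Set) → IsElementarySubstructure M G₀ →
    (m : ℕ) (c : Fin m → LlogStr.Car M) →
    (∀ i → c i ≢ LlogStr.∞ M × ¬ G₀ (c i)) →
    NewCard≤ M G₀ c (suc m)
    × Σ ℕ (λ n → n ≤ suc m × Σ (Fin n → LlogStr.Car M) (λ d →
        Injective _≡_ _≡_ d × (∀ j → InNew M G₀ c (d j)) ×
        (∀ y → InPExt M G₀ c y → y ≡ LlogStr.∞ M ⊎ InSpan M G₀ c d y)))
proposition6p4 em M T G₀ G₀≼M m c c-new = new-card≤1+m , spanning-enumeration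
  where open Proposition em M T G₀ G₀≼M c (λ i → proj₁ (c-new i))
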